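{- The vectors $v_C$, $C\in\mathbf{C}(2)$, form a basis of $W(\Lambda_2)$.
   Context: $U_q(G_2)$ is the $\mathbb{Q}(q)$-algebra generated by $e_i,f_i,t_i^{\pm1}$ ($i=1,2$) with Drinfeld–Jimbo relations for the Cartan matrix $\begin{pmatrix}2&-1\\-3&2\end{pmatrix}$, $q_1=q,q_2=q^3$; tensor products: $t_i(u\otimes v)=t_iu\otimes t_iv$, $e_i(u\otimes v)=e_iu\otimes t_i^{ -1}v+u\otimes e_iv$, $f_i(u\otimes v)=f_iu\otimes v+t_iu\otimes f_iv$. $\mathcal{G}=\{1,2,3,0,\bar3,\bar2,\bar1\}$ with $1\prec2\prec3\prec0\prec\bar3\prec\bar2\prec\bar1$; chain $1\xrightarrow{1}2\xrightarrow{2}3\xrightarrow{1}0\xrightarrow{1}\bar3\xrightarrow{2}\bar2\xrightarrow{1}\bar1$. $V(\Lambda_1)$ (the 7-dimensional irreducible module) has basis $\{v_x\}_{x\in\mathcal{G}}$ with $t_iv_x=q_i^{m_i(x)}v_x$, $(m_1,m_2)=(1,0),(-1,1),(2,-1),(0,0),(-2,1),(1,-1),(-1,0)$ for $x=1,2,3,0,\bar3,\bar2,\bar1$; for $x\neq0$, $f_iv_x=v_y$ if $x\xrightarrow{i}y$, else $0$, and $e_iv_x=v_y$ if $y\xrightarrow{i}x$, else $0$; $f_iv_0=\delta_{i,1}(q+q^{ -1})v_{\bar3}$, $e_iv_0=\delta_{i,1}(q+q^{ -1})v_3$. $W(\Lambda_2)=V(\Lambda_1)^{\otimes2}/N$ where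 $N\cong V(2\Lambda_1)$ is the corresponding irreducible component of $V(\Lambda_1)^{\otimes2}\cong V(2\Lambda_1)\oplus V(\Lambda_2)\oplus V(\Lambda_1)\oplus V(0)$; $v_x\wedge v_y$ is the image of $v_x\otimes v_y$. $\mathbf{C}(2)$ is the set of columns of height 2, i.e. pairs (top $a$, bottom $b$) with $a,b\in\mathcal{G}$ and $a\prec b$, together with the column with $a=b=0$; for $C\in\mathbf{C}(2)$ with top $a$ and bottom $b$, $v_C=v_a\wedge v_b$. -}

module Defs where

open import Data.Integer as ℤ using (ℤ; +_; -[1+_]; 0ℤ; 1ℤ)
open import Data.Nat as ℕ using (ℕ; zero; suc; _<_)
open import Data.Nat.Properties using (_<?_)
open import Data.List using (List; []; _∷_; map)
open import Data.List.Relation.Unary.All using (All; all?)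
open import Data.Sum using (_⊎_; inj₁; inj₂)
open import Data.Product using (_×_; _,_)
open import Relation.Nullary using (¬_; Dec; yes; no)
open import Relation.Nullary.Decidable using (_⊎-dec_; _×-dec_)
open import Relation.Binary.PropositionalEquality using (_≡_; refl)

-- Polynomials in q with integer coefficients, constant term first.
Poly : Set
Poly = List ℤ

infixl 6 _+P_
infixl 7 _*P_

_+P_ : Poly → Poly → Poly
[]      +P r       = r
(a ∷ p) +P []      = a ∷ p
(a ∷ p) +P (b ∷ r) = (a ℤ.+ b) ∷ (p +P r)

scaleP : ℤ → Poly → Poly
scaleP a = map (a ℤ.*_)

negP : Poly → Poly
negP = map (λ a → ℤ.- a)

_*P_ : Poly → Poly → Poly
[]      *P r = []
(a ∷ p) *P r = scaleP a r +P (0ℤ ∷ (p *P r))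

IsZeroP : Poly → Set
IsZeroP = All (_≡ 0ℤ)

isZeroP? : (p : Poly) → Dec (IsZeroP p)
isZeroP? = all? (λ a → a ℤ.≟ 0ℤ)

-- equality of polynomials (trailing zeros ignored)
_≈P_ : Poly → Poly → Set
p ≈P r = IsZeroP (p +P negP r)

qPolyPow : ℕ → Poly
qPolyPow zero    = 1ℤ ∷ []
qPolyPow (suc n) = 0ℤ ∷ qPolyPow n

record RF : Set where
  constructor _/_⟨_⟩
  field
    num   : Poly
    den   : Poly
    den≠0 : ¬ IsZeroP den
open RF public

infix 4 _≈F_
_≈F_ : RF → RF → Set
x ≈F y = (num x *P den y) ≈P (num y *P den x)

oneNZ : ¬ IsZeroP (1ℤ ∷ [])
oneNZ (() All.∷ _)

qPowNZ : (n : ℕ) → ¬ IsZeroP (qPolyPow n)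
qPowNZ zero    = oneNZ
qPowNZ (suc n) (_ All.∷ z) = qPowNZ n z

fromPoly : Poly → RF
fromPoly p = p / (1ℤ ∷ []) ⟨ oneNZ ⟩

0F 1F : RF
0F = fromPoly []
1F = fromPoly (1ℤ ∷ [])

-- the product of nonzero denominators is nonzero; the 'yes' branch never
-- occurs mathematically (ℤ[q] is a domain) and is only there for totality.
mkRF : Poly → Poly → RF
mkRF a b with isZeroP? b
... | yes _ = 0F
... | no nz = a / b ⟨ nz ⟩

infixl 6 _+F_ _-F_
infixl 7 _*F_

_+F_ : RF → RF → RF
x +F y = mkRF (num x *P den y +P num y *P den x) (den x *P den y)

_*F_ : RF → RF → RF
x *F y = mkRF (num x *P num y) (den x *P den y)

-F_ : RF → RF
-F x = negP (num x) / den x ⟨ den≠0 x ⟩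

_-F_ : RF → RF → RF
x -F y = x +F (-F y)

qpow : ℤ → RF
qpow (+ n)      = fromPoly (qPolyPow n)
qpow -[1+ n ]   = (1ℤ ∷ []) / qPolyPow (suc n) ⟨ qPowNZ (suc n) ⟩

qint2 : RF
qint2 = qpow (+ 1) +F qpow (ℤ.- (+ 1))

data G : Set where
  g1 g2 g3 g0 g3' g2' g1' : G

rank : G → ℕ
rank g1  = 0
rank g2  = 1
rank g3  = 2
rank g0  = 3
rank g3' = 4
rank g2' = 5
rank g1' = 6

_≺_ : G → G → Set
a ≺ b = rank a < rank b

data I : Set where
  i1 i2 : I

-- q_i = q^{d_i}
d : I → ℤ
d i1 = + 1
d i2 = + 3

m : I → G → ℤ
m i1 g1  = + 1
m i1 g2  = ℤ.- (+ 1)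
m i1 g3  = + 2
m i1 g0  = + 0
m i1 g3' = ℤ.- (+ 2)
m i1 g2' = + 1
m i1 g1' = ℤ.- (+ 1)
m i2 g1  = + 0
m i2 g2  = + 1
m i2 g3  = ℤ.- (+ 1)
m i2 g0  = + 0
m i2 g3' = + 1
m i2 g2' = ℤ.- (+ 1)
m i2 g1' = + 0

-- vectors of V(Λ₁): coordinates w.r.t. the basis v_x
V : Set
V = G → RF

fV : I → V → V
fV i1 u g2  = u g1
fV i1 u g0  = u g3
fV i1 u g3' = qint2 *F u g0
fV i1 u g1' = u g2'
fV i2 u g3  = u g2
fV i2 u g2' = u g3'
fV _  u _   = 0F

eV : I → V → V
eV i1 u g1  = u g2
eV i1 u g3  = qint2 *F u g0
eV i1 u g0  = u g3'
eV i1 u g2' = u g1'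
eV i2 u g2  = u g3
eV i2 u g3' = u g2'
eV _  u _   = 0F

-- V(Λ₁) ⊗ V(Λ₁), coordinates w.r.t. v_x ⊗ v_y

V2 : Set
V2 = G → G → RF

_+V_ : V2 → V2 → V2
(w +V w') x y = w x y +F w' x y

_-V_ : V2 → V2 → V2
(w -V w') x y = w x y -F w' x y

_·V_ : RF → V2 → V2
(c ·V w) x y = c *F w x y

T2 : I → V2 → V2
T2 i w x y = qpow (d i ℤ.* (m i x ℤ.+ m i y)) *F w x y

Tinv2 : I → V2 → V2
Tinv2 i w x y = qpow (ℤ.- (d i ℤ.* (m i x ℤ.+ m i y))) *F w x y

E2 : I → V2 → V2
E2 i w x y = (eV i (λ x' → w x' y) x *F qpow (ℤ.- (d i ℤ.* m i y)))
             +F eV i (w x) y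

F2 : I → V2 → V2
F2 i w x y = fV i (λ x' → w x' y) x
             +F (qpow (d i ℤ.* m i x) *F fV i (w x) y)

δ : G → G → RF
δ g1 g1 = 1F
δ g2 g2 = 1F
δ g3 g3 = 1F
δ g0 g0 = 1F
δ g3' g3' = 1F
δ g2' g2' = 1F
δ g1' g1' = 1F
δ _ _ = 0F

vv : G → G → V2
vv a b x y = δ a x *F δ b y

-- N: the U_q(G₂)-submodule generated by the highest weight vector
-- v₁ ⊗ v₁ (weight 2Λ₁), i.e. the component ≅ V(2Λ₁).
data InN : V2 → Set where
  gen     : InN (vv g1 g1)
  add     : ∀ {w w'} → InN w → InN w' → InN (w +V w')
  scale   : ∀ {w} (c : RF) → InN w → InN (c ·V w)
  resp    : ∀ {w w'} → (∀ x y → w x y ≈F w' x y) → InN w → InN w'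
  actE    : ∀ {w} (i : I) → InN w → InN (E2 i w)
  actF    : ∀ {w} (i : I) → InN w → InN (F2 i w)
  actT    : ∀ {w} (i : I) → InN w → InN (T2 i w)
  actTinv : ∀ {w} (i : I) → InN w → InN (Tinv2 i w)

IsColumn : G → G → Set
IsColumn a b = (a ≺ b) ⊎ (a ≡ g0 × b ≡ g0)

isG0 : (a : G) → Dec (a ≡ g0)
isG0 g1  = no (λ ())
isG0 g2  = no (λ ())
isG0 g3  = no (λ ())
isG0 g0  = yes refl
isG0 g3' = no (λ ())
isG0 g2' = no (λ ())
isG0 g1' = no (λ ())

isColumn? : (a b : G) → Dec (IsColumn a b)
isColumn? a b = (rank a <? rank b) ⊎-dec (isG0 a ×-dec isG0 b)

Coeffs : Set
Coeffs = (a b : G) → IsColumn a b → RF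

-- Σ_C c_C v_C, with v_C = v_a ∧ v_b represented by v_a ⊗ v_b
comb : Coeffs → V2
comb c x y with isColumn? x y
... | yes p = c x y p
... | no _  = 0F

{-# OPTIONS --safe #-}
module Submission where

-- N is spanned by 27 explicit vectors n x y, one for every pair (x , y) that is
-- not a column (x ≻ y, or x = y ≠ 0).  Each is obtained from the highest weight
-- vector v₁ ⊗ v₁ by applying f₁ and f₂, and v_x ⊗ v_y is its only coordinate
-- outside the columns.  Subtracting Σ w_xy n x y from w therefore leaves a
-- combination of the v_a ⊗ v_b with (a , b) a column: the v_C span W(Λ₂).
--
-- For independence we use 22 linear forms π a b, one for each column, dual to
-- the column basis.  They vanish on v₁ ⊗ v₁, and for every generator X of
-- U_q(G₂) each π a b ∘ X is a combination of the π's, so their common kernel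
-- is a submodule and contains N.  A combination of the v_C lying in N thus has
-- all coordinates π a b equal to 0.
--
-- The identities in ℚ(q) about these finitely many vectors and forms are
-- checked by computation.  Reasoning about arbitrary vectors needs the ring
-- laws of ℚ(q) = Frac ℤ[q]; they reduce to polynomial identities once ℤ[q] is
-- known to be an integral domain, which makes equality by cross-multiplication
-- transitive.

open import Defs
open import Algebra.Bundles using (CommutativeRing; RawRing)
import Algebra.Solver.Ring as RingSolver
open import Algebra.Solver.Ring.AlmostCommutativeRing
  using (AlmostCommutativeRing; fromCommutativeRing; _-Raw-AlmostCommutative⟶_; Induced-equivalence)
open import Data.Fin as Fin using (Fin; zero; suc; #_)
import Data.Fin.Properties as Fin
import Data.Integer as ℤ
import Data.Integer.Properties as ℤ
open import Data.List using (List; []; _∷_; _++_)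
open import Data.List.Relation.Unary.All using ([]; _∷_)
open import Data.Maybe using (just; nothing)
open import Data.Nat using (ℕ; zero; suc)
open import Data.Nat.Properties using (<-irrelevant; <-irrefl)
open import Data.Product using (_×_; Σ; _,_)
open import Data.Sum as Sum using (_⊎_; inj₁; inj₂; [_,_]′)
open import Data.Vec using ([]; _∷_; lookup)
open import Data.Vec.Functional using (Vector)
open import Function using (_∘_; id; flip)
open import Level using (0ℓ; _⊔_)
open import Relation.Binary.Bundles using (Setoid)
open import Relation.Binary.Definitions using (DecidableEquality; WeaklyDecidable)
open import Relation.Binary.PropositionalEquality as ≡ using (_≡_; _≢_)
import Relation.Binary.Reasoning.Setoid as SetoidReasoning
open import Relation.Binary.Structures using (IsEquivalence)
open import Relation.Nullary using (¬_; Dec; yes; no; contradiction)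
open import Relation.Nullary.Decidable using (True; toWitness; map′; from-yes; ¬?; _×-dec_; _→-dec_)

-- Finite sums and formal combinations over 𝒢

enumG : Fin 7 → G
enumG = lookup (g1 ∷ g2 ∷ g3 ∷ g0 ∷ g3' ∷ g2' ∷ g1' ∷ [])

indexG : G → Fin 7
indexG g1  = # 0
indexG g2  = # 1
indexG g3  = # 2
indexG g0  = # 3
indexG g3' = # 4
indexG g2' = # 5
indexG g1' = # 6

enumG-indexG : ∀ x → enumG (indexG x) ≡ x
enumG-indexG g1  = ≡.refl
enumG-indexG g2  = ≡.refl
enumG-indexG g3  = ≡.refl
enumG-indexG g0  = ≡.refl
enumG-indexG g3' = ≡.refl
enumG-indexG g2' = ≡.refl
enumG-indexG g1' = ≡.refl

indexG-enumG : ∀ i → indexG (enumG i) ≡ i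
indexG-enumG = from-yes (Fin.all? λ i → indexG (enumG i) Fin.≟ i)

indexG-injective : ∀ {x y} → indexG x ≡ indexG y → x ≡ y
indexG-injective {x} {y} e = ≡.trans (≡.sym (enumG-indexG x)) (≡.trans (≡.cong enumG e) (enumG-indexG y))

infix 4 _≟G_
_≟G_ : DecidableEquality G
x ≟G y = map′ indexG-injective (≡.cong indexG) (indexG x Fin.≟ indexG y)

∀G? : {P : G → Set} → (∀ x → Dec (P x)) → Dec (∀ x → P x)
∀G? {P} P? = map′ (λ ∀i x → ≡.subst P (enumG-indexG x) (∀i (indexG x))) (λ ∀x → ∀x ∘ enumG)
                  (Fin.all? (P? ∘ enumG))

∀I? : {P : I → Set} → (∀ i → Dec (P i)) → Dec (∀ i → P i)
∀I? {P} P? = map′ (λ { (p₁ , p₂) i1 → p₁ ; (p₁ , p₂) i2 → p₂ }) (λ ∀i → ∀i i1 , ∀i i2)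
                  (P? i1 ×-dec P? i2)

module FormalCombinations {c ℓ} (R : CommutativeRing c ℓ) where

  open CommutativeRing R hiding (zero)
  open import Algebra.Properties.Semiring.Sum semiring
    using (sum; sum-cong-≋; sum-replicate-zero; ∑-distrib-+; *-distribˡ-sum)
  open import Algebra.Solver.Ring.NaturalCoefficients.Default commutativeSemiring
    using (solve; _:+_; _:*_; _:=_; con)
  open import Relation.Binary.Reasoning.Setoid setoid

  δᶠ : ∀ {n} → Fin n → Fin n → Carrier
  δᶠ zero    zero    = 1#
  δᶠ zero    (suc j) = 0#
  δᶠ (suc i) zero    = 0#
  δᶠ (suc i) (suc j) = δᶠ i j

  δᶠ-diag : ∀ {n} (i : Fin n) → δᶠ i i ≡ 1#
  δᶠ-diag zero    = ≡.refl
  δᶠ-diag (suc i) = δᶠ-diag i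

  δᶠ-off-diag : ∀ {n} {i j : Fin n} → i ≢ j → δᶠ i j ≡ 0#
  δᶠ-off-diag {i = zero}  {zero}  i≢j = contradiction ≡.refl i≢j
  δᶠ-off-diag {i = zero}  {suc j} _   = ≡.refl
  δᶠ-off-diag {i = suc i} {zero}  _   = ≡.refl
  δᶠ-off-diag {i = suc i} {suc j} i≢j = δᶠ-off-diag (i≢j ∘ ≡.cong suc)

  sum-zero : ∀ {n} (f : Vector Carrier n) → (∀ i → f i ≈ 0#) → sum f ≈ 0#
  sum-zero {n} f f≈0 = trans (sum-cong-≋ f≈0) (sum-replicate-zero n)

  sum-δᶠ : ∀ {n} (i : Fin n) (f : Vector Carrier n) → sum (λ j → δᶠ i j * f j) ≈ f i
  sum-δᶠ zero    f = trans (+-cong (*-identityˡ (f zero)) (sum-zero _ (λ j → zeroˡ (f (suc j)))))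
                           (+-identityʳ (f zero))
  sum-δᶠ (suc i) f = trans (+-cong (zeroˡ (f zero)) (sum-δᶠ i (f ∘ suc))) (+-identityˡ (f (suc i)))

  ΣG : (G → Carrier) → Carrier
  ΣG f = sum (f ∘ enumG)

  ΣG-cong : ∀ {f g} → (∀ x → f x ≈ g x) → ΣG f ≈ ΣG g
  ΣG-cong f≈g = sum-cong-≋ (f≈g ∘ enumG)

  ΣG-+ : ∀ f g → ΣG (λ x → f x + g x) ≈ ΣG f + ΣG g
  ΣG-+ f g = ∑-distrib-+ (f ∘ enumG) (g ∘ enumG)

  ΣG-*ˡ : ∀ k f → ΣG (λ x → k * f x) ≈ k * ΣG f
  ΣG-*ˡ k f = sym (*-distribˡ-sum k (f ∘ enumG))

  ΣG-zero : ∀ {f} → (∀ x → f x ≈ 0#) → ΣG f ≈ 0#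
  ΣG-zero {f} f≈0 = sum-zero (f ∘ enumG) (f≈0 ∘ enumG)

  δᴳ : G → G → Carrier
  δᴳ a x = δᶠ (indexG a) (indexG x)

  δᴳ-diag-* : ∀ a u → δᴳ a a * u ≈ u
  δᴳ-diag-* a u = trans (*-congʳ (reflexive (δᶠ-diag (indexG a)))) (*-identityˡ u)

  δᴳ-off-diag-* : ∀ {a x} → a ≢ x → ∀ u → δᴳ a x * u ≈ 0#
  δᴳ-off-diag-* a≢x u = trans (*-congʳ (reflexive (δᶠ-off-diag (a≢x ∘ indexG-injective)))) (zeroˡ u)

  ΣG-δ : ∀ a f → ΣG (λ x → δᴳ a x * f x) ≈ f a
  ΣG-δ a f = begin
    sum (λ j → δᶠ (indexG a) (indexG (enumG j)) * f (enumG j))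
      ≈⟨ sum-cong-≋ (λ j → *-congʳ {f (enumG j)} (reflexive (≡.cong (δᶠ (indexG a)) (indexG-enumG j)))) ⟩
    sum (λ j → δᶠ (indexG a) j * f (enumG j))
      ≈⟨ sum-δᶠ (indexG a) (f ∘ enumG) ⟩
    f (enumG (indexG a))
      ≡⟨ ≡.cong f (enumG-indexG a) ⟩
    f a ∎

  Tensor : Set c
  Tensor = G → G → Carrier

  ΣΣ : Tensor → Carrier
  ΣΣ f = ΣG λ x → ΣG λ y → f x y

  ΣΣ-cong : ∀ {f g} → (∀ x y → f x y ≈ g x y) → ΣΣ f ≈ ΣΣ g
  ΣΣ-cong f≈g = ΣG-cong λ x → ΣG-cong (f≈g x)

  ΣΣ-+ : ∀ f g → ΣΣ (λ x y → f x y + g x y) ≈ ΣΣ f + ΣΣ g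
  ΣΣ-+ f g = trans (ΣG-cong λ x → ΣG-+ (f x) (g x)) (ΣG-+ (λ x → ΣG (f x)) (λ x → ΣG (g x)))

  ΣΣ-zero : ∀ {f} → (∀ x y → f x y ≈ 0#) → ΣΣ f ≈ 0#
  ΣΣ-zero f≈0 = ΣG-zero λ x → ΣG-zero (f≈0 x)

  ΣΣ-δ : ∀ a b (f : Tensor) → ΣΣ (λ x y → δᴳ a x * (δᴳ b y * f x y)) ≈ f a b
  ΣΣ-δ a b f = begin
    ΣG (λ x → ΣG λ y → δᴳ a x * (δᴳ b y * f x y))
      ≈⟨ ΣG-cong (λ x → ΣG-*ˡ (δᴳ a x) (λ y → δᴳ b y * f x y)) ⟩
    ΣG (λ x → δᴳ a x * ΣG (λ y → δᴳ b y * f x y))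
      ≈⟨ ΣG-cong (λ x → *-congˡ {δᴳ a x} (ΣG-δ b (f x))) ⟩
    ΣG (λ x → δᴳ a x * f x b)
      ≈⟨ ΣG-δ a (λ x → f x b) ⟩
    f a b ∎

  -- A finite combination Σ k · v_x ⊗ v_y, read either as a tensor (dense) or
  -- as the linear form pairing with the dual basis (⟨_∣_⟩).
  Sparse : Set c
  Sparse = List (Carrier × G × G)

  ⟨_∣_⟩ : Sparse → Tensor → Carrier
  ⟨ []              ∣ w ⟩ = 0#
  ⟨ (k , x , y) ∷ l ∣ w ⟩ = k * w x y + ⟨ l ∣ w ⟩

  dense : Sparse → Tensor
  dense []                x y = 0#
  dense ((k , a , b) ∷ l) x y with a ≟G x | b ≟G y
  ... | yes _ | yes _ = k + dense l x y
  ... | _     | _     = dense l x y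

  dense-∷ : ∀ k a b l x y → dense ((k , a , b) ∷ l) x y ≈ δᴳ a x * (δᴳ b y * k) + dense l x y
  dense-∷ k a b l x y with a ≟G x | b ≟G y
  ... | yes ≡.refl | yes ≡.refl = sym (+-congʳ (trans (δᴳ-diag-* a _) (δᴳ-diag-* b k)))
  ... | yes ≡.refl | no b≢y     =
    sym (trans (+-congʳ (trans (δᴳ-diag-* a _) (δᴳ-off-diag-* b≢y k))) (+-identityˡ _))
  ... | no a≢x     | _          = sym (trans (+-congʳ (δᴳ-off-diag-* a≢x _)) (+-identityˡ _))

  ⟨⟩-dense : ∀ l w → ⟨ l ∣ w ⟩ ≈ ΣΣ (λ x y → dense l x y * w x y)
  ⟨⟩-dense []                w = sym (ΣΣ-zero λ x y → zeroˡ (w x y))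
  ⟨⟩-dense ((k , a , b) ∷ l) w = begin
    k * w a b + ⟨ l ∣ w ⟩
      ≈⟨ +-cong (sym (ΣΣ-δ a b (λ x y → k * w x y))) (⟨⟩-dense l w) ⟩
    ΣΣ (λ x y → δᴳ a x * (δᴳ b y * (k * w x y))) + ΣΣ (λ x y → dense l x y * w x y)
      ≈⟨ ΣΣ-+ (λ x y → δᴳ a x * (δᴳ b y * (k * w x y))) (λ x y → dense l x y * w x y) ⟨
    ΣΣ (λ x y → δᴳ a x * (δᴳ b y * (k * w x y)) + dense l x y * w x y)
      ≈⟨ ΣΣ-cong (λ x y → solve 5 (λ p q k v d → p :* (q :* (k :* v)) :+ d :* v := (p :* (q :* k) :+ d) :* v)
                                 refl (δᴳ a x) (δᴳ b y) k (w x y) (dense l x y)) ⟩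
    ΣΣ (λ x y → (δᴳ a x * (δᴳ b y * k) + dense l x y) * w x y)
      ≈⟨ ΣΣ-cong (λ x y → *-congʳ {w x y} (dense-∷ k a b l x y)) ⟨
    ΣΣ (λ x y → dense ((k , a , b) ∷ l) x y * w x y) ∎

  ⟨⟩-cong-dense : ∀ l l′ → (∀ x y → dense l x y ≈ dense l′ x y) →
                  ∀ w → ⟨ l ∣ w ⟩ ≈ ⟨ l′ ∣ w ⟩
  ⟨⟩-cong-dense l l′ l≈l′ w =
    trans (⟨⟩-dense l w) (trans (ΣΣ-cong λ x y → *-congʳ {w x y} (l≈l′ x y)) (sym (⟨⟩-dense l′ w)))

  ⟨⟩-cong : ∀ l {w w′} → (∀ x y → w x y ≈ w′ x y) → ⟨ l ∣ w ⟩ ≈ ⟨ l ∣ w′ ⟩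
  ⟨⟩-cong []                w≈w′ = refl
  ⟨⟩-cong ((k , x , y) ∷ l) w≈w′ = +-cong (*-congˡ (w≈w′ x y)) (⟨⟩-cong l w≈w′)

  ⟨⟩-zero : ∀ l {w} → (∀ x y → w x y ≈ 0#) → ⟨ l ∣ w ⟩ ≈ 0#
  ⟨⟩-zero []                w≈0 = refl
  ⟨⟩-zero ((k , x , y) ∷ l) w≈0 =
    trans (+-cong (trans (*-congˡ (w≈0 x y)) (zeroʳ k)) (⟨⟩-zero l w≈0)) (+-identityˡ 0#)

  ⟨⟩-+ : ∀ l w w′ → ⟨ l ∣ (λ x y → w x y + w′ x y) ⟩ ≈ ⟨ l ∣ w ⟩ + ⟨ l ∣ w′ ⟩
  ⟨⟩-+ []                w w′ = sym (+-identityˡ 0#)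
  ⟨⟩-+ ((k , x , y) ∷ l) w w′ = trans (+-congˡ (⟨⟩-+ l w w′))
    (solve 5 (λ k a b d e → k :* (a :+ b) :+ (d :+ e) := (k :* a :+ d) :+ (k :* b :+ e))
           refl k (w x y) (w′ x y) ⟨ l ∣ w ⟩ ⟨ l ∣ w′ ⟩)

  ⟨⟩-*ˡ : ∀ l c w → ⟨ l ∣ (λ x y → c * w x y) ⟩ ≈ c * ⟨ l ∣ w ⟩
  ⟨⟩-*ˡ []                c w = sym (zeroʳ c)
  ⟨⟩-*ˡ ((k , x , y) ∷ l) c w = trans (+-congˡ (⟨⟩-*ˡ l c w))
    (solve 4 (λ k c a b → k :* (c :* a) :+ c :* b := c :* (k :* a :+ b)) refl k c (w x y) ⟨ l ∣ w ⟩)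

  ⟨⟩-++ : ∀ l l′ w → ⟨ l ++ l′ ∣ w ⟩ ≈ ⟨ l ∣ w ⟩ + ⟨ l′ ∣ w ⟩
  ⟨⟩-++ []                l′ w = sym (+-identityˡ ⟨ l′ ∣ w ⟩)
  ⟨⟩-++ ((k , x , y) ∷ l) l′ w =
    trans (+-congˡ (⟨⟩-++ l l′ w)) (sym (+-assoc (k * w x y) ⟨ l ∣ w ⟩ ⟨ l′ ∣ w ⟩))

  infixr 7 _⊙_
  _⊙_ : Carrier → Sparse → Sparse
  c ⊙ []                = []
  c ⊙ ((k , x , y) ∷ l) = (c * k , x , y) ∷ c ⊙ l

  ⟨⊙⟩ : ∀ c l w → ⟨ c ⊙ l ∣ w ⟩ ≈ c * ⟨ l ∣ w ⟩
  ⟨⊙⟩ c []                w = sym (zeroʳ c)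
  ⟨⊙⟩ c ((k , x , y) ∷ l) w = trans (+-congˡ (⟨⊙⟩ c l w))
    (solve 4 (λ c k a b → (c :* k) :* a :+ c :* b := c :* (k :* a :+ b)) refl c k (w x y) ⟨ l ∣ w ⟩)

  infixl 6 _▷_
  _▷_ : Sparse → (G → G → Sparse) → Sparse
  []                ▷ M = []
  ((k , x , y) ∷ l) ▷ M = k ⊙ M x y ++ l ▷ M

  ⟨▷⟩ : ∀ l M w → ⟨ l ▷ M ∣ w ⟩ ≈ ⟨ l ∣ (λ x y → ⟨ M x y ∣ w ⟩) ⟩
  ⟨▷⟩ []                M w = refl
  ⟨▷⟩ ((k , x , y) ∷ l) M w =
    trans (⟨⟩-++ (k ⊙ M x y) (l ▷ M) w) (+-cong (⟨⊙⟩ k (M x y) w) (⟨▷⟩ l M w))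

  Rows : (Tensor → Tensor) → (G → G → Sparse) → Set (c ⊔ ℓ)
  Rows op M = ∀ w x y → op w x y ≈ ⟨ M x y ∣ w ⟩

  -- π a b ▷ M is the pull-back of π a b along op; the hypothesis says that it
  -- coincides with its re-expansion in the π's.
  kernel-stable : ∀ {op M} → Rows op M → (π : G → G → Sparse) →
                  (∀ a b x y → dense (π a b ▷ M) x y ≈ dense (π a b ▷ M ▷ π) x y) →
                  ∀ {w} → (∀ a b → ⟨ π a b ∣ w ⟩ ≈ 0#) → ∀ a b → ⟨ π a b ∣ op w ⟩ ≈ 0#
  kernel-stable {op} {M} rows π closed {w} πw≈0 a b = begin
    ⟨ π a b ∣ op w ⟩                              ≈⟨ ⟨⟩-cong (π a b) (rows w) ⟩
    ⟨ π a b ∣ (λ x y → ⟨ M x y ∣ w ⟩) ⟩           ≈⟨ ⟨▷⟩ (π a b) M w ⟨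
    ⟨ π a b ▷ M ∣ w ⟩                             ≈⟨ ⟨⟩-cong-dense (π a b ▷ M) (π a b ▷ M ▷ π) (closed a b) w ⟩
    ⟨ π a b ▷ M ▷ π ∣ w ⟩                         ≈⟨ ⟨▷⟩ (π a b ▷ M) π w ⟩
    ⟨ π a b ▷ M ∣ (λ x y → ⟨ π x y ∣ w ⟩) ⟩       ≈⟨ ⟨⟩-zero (π a b ▷ M) πw≈0 ⟩
    0#                                            ∎

  Sparse₁ : Set c
  Sparse₁ = List (Carrier × G)

  ⟨_∣_⟩₁ : Sparse₁ → (G → Carrier) → Carrier
  ⟨ []          ∣ u ⟩₁ = 0#
  ⟨ (k , x) ∷ r ∣ u ⟩₁ = k * u x + ⟨ r ∣ u ⟩₁

  infix 8 _⊗ˡ_ _⊗ʳ_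
  _⊗ˡ_ : Sparse₁ → G → Sparse
  []          ⊗ˡ y = []
  ((k , x) ∷ r) ⊗ˡ y = (k , x , y) ∷ r ⊗ˡ y

  _⊗ʳ_ : G → Sparse₁ → Sparse
  x ⊗ʳ []            = []
  x ⊗ʳ ((k , y) ∷ r) = (k , x , y) ∷ x ⊗ʳ r

  ⟨⊗ˡ⟩ : ∀ r y w → ⟨ r ⊗ˡ y ∣ w ⟩ ≈ ⟨ r ∣ (λ x → w x y) ⟩₁
  ⟨⊗ˡ⟩ []            y w = refl
  ⟨⊗ˡ⟩ ((k , x) ∷ r) y w = +-congˡ (⟨⊗ˡ⟩ r y w)

  ⟨⊗ʳ⟩ : ∀ x r w → ⟨ x ⊗ʳ r ∣ w ⟩ ≈ ⟨ r ∣ w x ⟩₁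
  ⟨⊗ʳ⟩ x []            w = refl
  ⟨⊗ʳ⟩ x ((k , y) ∷ r) w = +-congˡ (⟨⊗ʳ⟩ x r w)

  ⟨⟩-coordinate : ∀ l w a b → (∀ x y → dense l x y * w x y ≈ δᴳ a x * (δᴳ b y * w x y)) →
                  ⟨ l ∣ w ⟩ ≈ w a b
  ⟨⟩-coordinate l w a b agree = trans (⟨⟩-dense l w) (trans (ΣΣ-cong agree) (ΣΣ-δ a b w))

  ΣV : (G → Tensor) → Tensor
  ΣV f x y = sum (λ i → f (enumG i) x y)

  module _ {p} (P : Tensor → Set p) (P-0 : P (λ _ _ → 0#))
           (P-+ : ∀ {u v} → P u → P v → P (λ x y → u x y + v x y)) where

    sum-closed : ∀ {k} (f : Fin k → Tensor) → (∀ i → P (f i)) → P (λ x y → sum (λ i → f i x y))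
    sum-closed {zero}  f Pf = P-0
    sum-closed {suc k} f Pf = P-+ (Pf zero) (sum-closed (f ∘ suc) (Pf ∘ suc))

    ΣV-closed : ∀ f → (∀ x → P (f x)) → P (ΣV f)
    ΣV-closed f Pf = sum-closed (f ∘ enumG) (Pf ∘ enumG)

  expand : (G → G → Tensor) → Tensor → Tensor
  expand n w = ΣV λ x′ → ΣV λ y′ x y → w x′ y′ * n x′ y′ x y

  expand-closed : ∀ {p} (P : Tensor → Set p) → P (λ _ _ → 0#) →
                  (∀ {u v} → P u → P v → P (λ x y → u x y + v x y)) →
                  (∀ {u} k → P u → P (λ x y → k * u x y)) →
                  ∀ n → (∀ x y → P (n x y)) → ∀ w → P (expand n w)
  expand-closed P P-0 P-+ P-* n Pn w =
    ΣV-closed P P-0 P-+ _ λ x′ → ΣV-closed P P-0 P-+ _ λ y′ → P-* (w x′ y′) (Pn x′ y′)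

  expand-sift : ∀ n w x y → (∀ x′ y′ → n x′ y′ x y ≈ δᴳ x x′ * δᴳ y y′) → expand n w x y ≈ w x y
  expand-sift n w x y n≈δ = trans (ΣΣ-cong rearrange) (ΣΣ-δ x y w)
    where
    rearrange : ∀ x′ y′ → w x′ y′ * n x′ y′ x y ≈ δᴳ x x′ * (δᴳ y y′ * w x′ y′)
    rearrange x′ y′ = trans (*-congˡ (n≈δ x′ y′))
      (solve 3 (λ w a b → w :* (a :* b) := a :* (b :* w)) refl (w x′ y′) (δᴳ x x′) (δᴳ y y′))

-- The polynomial ring ℤ[q]

coeff : Poly → ℕ → ℤ.ℤ
coeff []      _       = ℤ.0ℤ
coeff (a ∷ p) zero    = a
coeff (a ∷ p) (suc n) = coeff p n

infix 4 _≋_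
record _≋_ (p r : Poly) : Set where
  constructor mk≋
  field coeff-≡ : ∀ n → coeff p n ≡ coeff r n
open _≋_

≋-refl : ∀ {p} → p ≋ p
≋-refl = mk≋ λ _ → ≡.refl

≋-sym : ∀ {p r} → p ≋ r → r ≋ p
≋-sym p≋r = mk≋ (≡.sym ∘ coeff-≡ p≋r)

≋-trans : ∀ {p r s} → p ≋ r → r ≋ s → p ≋ s
≋-trans p≋r r≋s = mk≋ λ n → ≡.trans (coeff-≡ p≋r n) (coeff-≡ r≋s n)

≋-isEquivalence : IsEquivalence _≋_
≋-isEquivalence = record { refl = ≋-refl ; sym = ≋-sym ; trans = ≋-trans }

≋-setoid : Setoid 0ℓ 0ℓ
≋-setoid = record { isEquivalence = ≋-isEquivalence }

module ≋-Reasoning = SetoidReasoning ≋-setoid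

module _ where
  open import Data.Integer using (0ℤ; 1ℤ; _+_; _*_; -_)
  open ≡ using (refl; sym; trans; cong; cong₂)

  ∷-cong : ∀ {a p r} → p ≋ r → a ∷ p ≋ a ∷ r
  ∷-cong p≋r = mk≋ λ { zero → refl ; (suc n) → coeff-≡ p≋r n }

  ∷-cong₂ : ∀ {a b p r} → a ≡ b → p ≋ r → a ∷ p ≋ b ∷ r
  ∷-cong₂ refl = ∷-cong

  ∷-≋[] : ∀ {a p} → a ≡ 0ℤ → p ≋ [] → a ∷ p ≋ []
  ∷-≋[] a≡0 p≋[] = mk≋ λ { zero → a≡0 ; (suc n) → coeff-≡ p≋[] n }

  tail-≋[] : ∀ {a p} → a ∷ p ≋ [] → p ≋ []
  tail-≋[] a∷p≋[] = mk≋ (coeff-≡ a∷p≋[] ∘ suc)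

  coeff-+P : ∀ p r n → coeff (p +P r) n ≡ coeff p n + coeff r n
  coeff-+P []      r       n       = sym (ℤ.+-identityˡ _)
  coeff-+P (a ∷ p) []      n       = sym (ℤ.+-identityʳ _)
  coeff-+P (a ∷ p) (b ∷ r) zero    = refl
  coeff-+P (a ∷ p) (b ∷ r) (suc n) = coeff-+P p r n

  coeff-negP : ∀ p n → coeff (negP p) n ≡ - coeff p n
  coeff-negP []      n       = refl
  coeff-negP (a ∷ p) zero    = refl
  coeff-negP (a ∷ p) (suc n) = coeff-negP p n

  coeff-scaleP : ∀ a p n → coeff (scaleP a p) n ≡ a * coeff p n
  coeff-scaleP a []      n       = sym (ℤ.*-zeroʳ a)
  coeff-scaleP a (b ∷ p) zero    = refl
  coeff-scaleP a (b ∷ p) (suc n) = coeff-scaleP a p n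

  coeff-*P-zero : ∀ a p s → coeff ((a ∷ p) *P s) zero ≡ a * coeff s zero
  coeff-*P-zero a p s =
    trans (coeff-+P (scaleP a s) (0ℤ ∷ p *P s) zero) (trans (ℤ.+-identityʳ _) (coeff-scaleP a s zero))

  coeff-*P-suc : ∀ a p s n → coeff ((a ∷ p) *P s) (suc n) ≡ a * coeff s (suc n) + coeff (p *P s) n
  coeff-*P-suc a p s n =
    trans (coeff-+P (scaleP a s) (0ℤ ∷ p *P s) (suc n)) (cong (_+ coeff (p *P s) n) (coeff-scaleP a s (suc n)))

  convolution : (ℕ → ℤ.ℤ) → (ℕ → ℤ.ℤ) → ℕ → ℤ.ℤ
  convolution f g zero    = f 0 * g 0
  convolution f g (suc n) = f 0 * g (suc n) + convolution (f ∘ suc) g n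

  convolution-zeroˡ : ∀ g n → convolution (λ _ → 0ℤ) g n ≡ 0ℤ
  convolution-zeroˡ g zero    = ℤ.*-zeroˡ (g 0)
  convolution-zeroˡ g (suc n) = cong₂ _+_ (ℤ.*-zeroˡ (g (suc n))) (convolution-zeroˡ g n)

  convolution-cong : ∀ {f f′ g g′} → (∀ k → f k ≡ f′ k) → (∀ k → g k ≡ g′ k) →
                     ∀ n → convolution f g n ≡ convolution f′ g′ n
  convolution-cong f≗ g≗ zero    = cong₂ _*_ (f≗ 0) (g≗ 0)
  convolution-cong f≗ g≗ (suc n) = cong₂ _+_ (cong₂ _*_ (f≗ 0) (g≗ (suc n))) (convolution-cong (f≗ ∘ suc) g≗ n)

  coeff-*P : ∀ p s n → coeff (p *P s) n ≡ convolution (coeff p) (coeff s) n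
  coeff-*P []      s n       = sym (convolution-zeroˡ (coeff s) n)
  coeff-*P (a ∷ p) s zero    = coeff-*P-zero a p s
  coeff-*P (a ∷ p) s (suc n) = trans (coeff-*P-suc a p s n) (cong (a * coeff s (suc n) +_) (coeff-*P p s n))

  +P-cong : ∀ {p p′ r r′} → p ≋ p′ → r ≋ r′ → p +P r ≋ p′ +P r′
  +P-cong {p} {p′} {r} {r′} p≋ r≋ = mk≋ λ n →
    trans (coeff-+P p r n) (trans (cong₂ _+_ (coeff-≡ p≋ n) (coeff-≡ r≋ n)) (sym (coeff-+P p′ r′ n)))

  negP-cong : ∀ {p p′} → p ≋ p′ → negP p ≋ negP p′
  negP-cong {p} {p′} p≋ = mk≋ λ n → trans (coeff-negP p n) (trans (cong -_ (coeff-≡ p≋ n)) (sym (coeff-negP p′ n)))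

  *P-cong : ∀ {p p′ r r′} → p ≋ p′ → r ≋ r′ → p *P r ≋ p′ *P r′
  *P-cong {p} {p′} {r} {r′} p≋ r≋ = mk≋ λ n →
    trans (coeff-*P p r n) (trans (convolution-cong (coeff-≡ p≋) (coeff-≡ r≋) n) (sym (coeff-*P p′ r′ n)))

  +P-comm : ∀ p r → p +P r ≋ r +P p
  +P-comm p r = mk≋ λ n → trans (coeff-+P p r n) (trans (ℤ.+-comm (coeff p n) (coeff r n)) (sym (coeff-+P r p n)))

  +P-assoc : ∀ p r s → (p +P r) +P s ≋ p +P (r +P s)
  +P-assoc p r s = mk≋ λ n → begin
    coeff ((p +P r) +P s) n                   ≡⟨ coeff-+P (p +P r) s n ⟩
    coeff (p +P r) n + coeff s n              ≡⟨ cong (_+ coeff s n) (coeff-+P p r n) ⟩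
    (coeff p n + coeff r n) + coeff s n       ≡⟨ ℤ.+-assoc (coeff p n) (coeff r n) (coeff s n) ⟩
    coeff p n + (coeff r n + coeff s n)       ≡⟨ cong (coeff p n +_) (coeff-+P r s n) ⟨
    coeff p n + coeff (r +P s) n              ≡⟨ coeff-+P p (r +P s) n ⟨
    coeff (p +P (r +P s)) n                   ∎
    where open ≡.≡-Reasoning

  +P-identityʳ : ∀ p → p +P [] ≋ p
  +P-identityʳ []      = ≋-refl
  +P-identityʳ (a ∷ p) = ≋-refl

  +P-inverseˡ : ∀ p → negP p +P p ≋ []
  +P-inverseˡ p = mk≋ λ n →
    trans (coeff-+P (negP p) p n) (trans (cong (_+ coeff p n) (coeff-negP p n)) (ℤ.+-inverseˡ (coeff p n)))

  +P-inverseʳ : ∀ p → p +P negP p ≋ []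
  +P-inverseʳ p = ≋-trans (+P-comm p (negP p)) (+P-inverseˡ p)

  +P-swap : ∀ p r s → p +P (r +P s) ≋ r +P (p +P s)
  +P-swap p r s = ≋-trans (≋-sym (+P-assoc p r s)) (≋-trans (+P-cong (+P-comm p r) ≋-refl) (+P-assoc r p s))

  +P-interchange : ∀ w x y z → (w +P x) +P (y +P z) ≋ (w +P y) +P (x +P z)
  +P-interchange w x y z = ≋-trans (+P-assoc w x (y +P z))
    (≋-trans (+P-cong (≋-refl {w}) (+P-swap x y z)) (≋-sym (+P-assoc w y (x +P z))))

  scaleP-distrib-+ : ∀ a b p → scaleP (a + b) p ≋ scaleP a p +P scaleP b p
  scaleP-distrib-+ a b p = mk≋ λ n → begin
    coeff (scaleP (a + b) p) n                   ≡⟨ coeff-scaleP (a + b) p n ⟩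
    (a + b) * coeff p n                          ≡⟨ ℤ.*-distribʳ-+ (coeff p n) a b ⟩
    a * coeff p n + b * coeff p n                ≡⟨ cong₂ _+_ (coeff-scaleP a p n) (coeff-scaleP b p n) ⟨
    coeff (scaleP a p) n + coeff (scaleP b p) n  ≡⟨ coeff-+P (scaleP a p) (scaleP b p) n ⟨
    coeff (scaleP a p +P scaleP b p) n           ∎
    where open ≡.≡-Reasoning

  scaleP-≡0 : ∀ {a} p → a ≡ 0ℤ → scaleP a p ≋ []
  scaleP-≡0 p refl = mk≋ λ n → trans (coeff-scaleP 0ℤ p n) (ℤ.*-zeroˡ (coeff p n))

  scaleP-+P : ∀ a p r → scaleP a (p +P r) ≋ scaleP a p +P scaleP a r
  scaleP-+P a p r = mk≋ λ n → begin
    coeff (scaleP a (p +P r)) n                  ≡⟨ coeff-scaleP a (p +P r) n ⟩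
    a * coeff (p +P r) n                         ≡⟨ cong (a *_) (coeff-+P p r n) ⟩
    a * (coeff p n + coeff r n)                  ≡⟨ ℤ.*-distribˡ-+ a (coeff p n) (coeff r n) ⟩
    a * coeff p n + a * coeff r n                ≡⟨ cong₂ _+_ (coeff-scaleP a p n) (coeff-scaleP a r n) ⟨
    coeff (scaleP a p) n + coeff (scaleP a r) n  ≡⟨ coeff-+P (scaleP a p) (scaleP a r) n ⟨
    coeff (scaleP a p +P scaleP a r) n           ∎
    where open ≡.≡-Reasoning

  scaleP-scaleP : ∀ a b p → scaleP (a * b) p ≋ scaleP a (scaleP b p)
  scaleP-scaleP a b p = mk≋ λ n →
    trans (coeff-scaleP (a * b) p n)
          (trans (ℤ.*-assoc a b (coeff p n)) (sym (trans (coeff-scaleP a (scaleP b p) n) (cong (a *_) (coeff-scaleP b p n)))))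

  ∷-*P-≡0 : ∀ {a} p s → a ≡ 0ℤ → (a ∷ p) *P s ≋ 0ℤ ∷ p *P s
  ∷-*P-≡0 p s a≡0 = +P-cong (scaleP-≡0 s a≡0) ≋-refl

  *P-zeroʳ : ∀ p → p *P [] ≋ []
  *P-zeroʳ []      = ≋-refl
  *P-zeroʳ (a ∷ p) = ∷-≋[] refl (*P-zeroʳ p)

  *P-∷ʳ : ∀ r a p → r *P (a ∷ p) ≋ scaleP a r +P (0ℤ ∷ r *P p)
  *P-∷ʳ []      a p = mk≋ λ { zero → refl ; (suc n) → refl }
  *P-∷ʳ (b ∷ r) a p = ∷-cong₂ (cong (_+ 0ℤ) (ℤ.*-comm b a))
    (≋-trans (+P-cong ≋-refl (*P-∷ʳ r a p)) (+P-swap (scaleP b p) (scaleP a r) (0ℤ ∷ r *P p)))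

  *P-comm : ∀ p r → p *P r ≋ r *P p
  *P-comm []      r = ≋-sym (*P-zeroʳ r)
  *P-comm (a ∷ p) r = ≋-sym (≋-trans (*P-∷ʳ r a p) (+P-cong ≋-refl (∷-cong (*P-comm r p))))

  *P-distribʳ : ∀ s p r → (p +P r) *P s ≋ p *P s +P r *P s
  *P-distribʳ s []      r       = ≋-refl
  *P-distribʳ s (a ∷ p) []      = ≋-sym (+P-identityʳ _)
  *P-distribʳ s (a ∷ p) (b ∷ r) = begin
    scaleP (a + b) s +P (0ℤ ∷ (p +P r) *P s)
      ≈⟨ +P-cong (scaleP-distrib-+ a b s) (∷-cong (*P-distribʳ s p r)) ⟩
    (scaleP a s +P scaleP b s) +P ((0ℤ ∷ p *P s) +P (0ℤ ∷ r *P s))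
      ≈⟨ +P-interchange (scaleP a s) (scaleP b s) (0ℤ ∷ p *P s) (0ℤ ∷ r *P s) ⟩
    (scaleP a s +P (0ℤ ∷ p *P s)) +P (scaleP b s +P (0ℤ ∷ r *P s)) ∎
    where open ≋-Reasoning

  scaleP-*P : ∀ a r s → scaleP a r *P s ≋ scaleP a (r *P s)
  scaleP-*P a []      s = ≋-refl
  scaleP-*P a (b ∷ r) s = begin
    scaleP (a * b) s +P (0ℤ ∷ scaleP a r *P s)        ≈⟨ +P-cong (scaleP-scaleP a b s)
                                                           (∷-cong₂ (sym (ℤ.*-zeroʳ a)) (scaleP-*P a r s)) ⟩
    scaleP a (scaleP b s) +P scaleP a (0ℤ ∷ r *P s)   ≈⟨ scaleP-+P a (scaleP b s) (0ℤ ∷ r *P s) ⟨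
    scaleP a (scaleP b s +P (0ℤ ∷ r *P s))            ∎
    where open ≋-Reasoning

  *P-assoc : ∀ p r s → (p *P r) *P s ≋ p *P (r *P s)
  *P-assoc []      r s = ≋-refl
  *P-assoc (a ∷ p) r s = begin
    (scaleP a r +P (0ℤ ∷ p *P r)) *P s         ≈⟨ *P-distribʳ s (scaleP a r) (0ℤ ∷ p *P r) ⟩
    scaleP a r *P s +P (0ℤ ∷ p *P r) *P s      ≈⟨ +P-cong (scaleP-*P a r s) (∷-*P-≡0 (p *P r) s refl) ⟩
    scaleP a (r *P s) +P (0ℤ ∷ (p *P r) *P s)  ≈⟨ +P-cong ≋-refl (∷-cong (*P-assoc p r s)) ⟩
    scaleP a (r *P s) +P (0ℤ ∷ p *P (r *P s))  ∎
    where open ≋-Reasoning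

  *P-identityˡ : ∀ p → (1ℤ ∷ []) *P p ≋ p
  *P-identityˡ p = ≋-trans (+P-cong (mk≋ λ n → trans (coeff-scaleP 1ℤ p n) (ℤ.*-identityˡ (coeff p n)))
                                    (∷-≋[] refl ≋-refl))
                           (+P-identityʳ p)

  Poly-commutativeRing : CommutativeRing 0ℓ 0ℓ
  Poly-commutativeRing = record
    { Carrier = Poly ; _≈_ = _≋_ ; _+_ = _+P_ ; _*_ = _*P_ ; -_ = negP ; 0# = [] ; 1# = 1ℤ ∷ []
    ; isCommutativeRing = record
      { isRing = record
        { +-isAbelianGroup = record
          { isGroup = record
            { isMonoid = record
              { isSemigroup = record
                { isMagma = record { isEquivalence = ≋-isEquivalence ; ∙-cong = +P-cong }
                ; assoc = +P-assoc }
              ; identity = (λ _ → ≋-refl) , +P-identityʳ }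
            ; inverse = +P-inverseˡ , +P-inverseʳ
            ; ⁻¹-cong = negP-cong }
          ; comm = +P-comm }
        ; *-cong = *P-cong
        ; *-assoc = *P-assoc
        ; *-identity = *P-identityˡ , λ p → ≋-trans (*P-comm p _) (*P-identityˡ p)
        ; distrib = (λ s p r → ≋-trans (*P-comm s (p +P r))
                                 (≋-trans (*P-distribʳ s p r) (+P-cong (*P-comm p s) (*P-comm r s))))
                  , *P-distribʳ }
      ; *-comm = *P-comm } }

  IsZeroP⇒≋[] : ∀ {p} → IsZeroP p → p ≋ []
  IsZeroP⇒≋[] []         = ≋-refl
  IsZeroP⇒≋[] (a≡0 ∷ p0) = ∷-≋[] a≡0 (IsZeroP⇒≋[] p0)

  ≋[]⇒IsZeroP : ∀ p → p ≋ [] → IsZeroP p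
  ≋[]⇒IsZeroP []      _    = []
  ≋[]⇒IsZeroP (a ∷ p) p≋[] = coeff-≡ p≋[] zero ∷ ≋[]⇒IsZeroP p (tail-≋[] p≋[])

  ≈P⇒≋ : ∀ {p r} → p ≈P r → p ≋ r
  ≈P⇒≋ {p} {r} p-r≈0 = mk≋ λ n → ℤ.i-j≡0⇒i≡j (coeff p n) (coeff r n) (begin
    coeff p n + - coeff r n        ≡⟨ cong (coeff p n +_) (coeff-negP r n) ⟨
    coeff p n + coeff (negP r) n   ≡⟨ coeff-+P p (negP r) n ⟨
    coeff (p +P negP r) n          ≡⟨ coeff-≡ (IsZeroP⇒≋[] p-r≈0) n ⟩
    0ℤ                             ∎)
    where open ≡.≡-Reasoning

  ≋⇒≈P : ∀ {p r} → p ≋ r → p ≈P r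
  ≋⇒≈P {p} {r} p≋r = ≋[]⇒IsZeroP (p +P negP r) (≋-trans (+P-cong p≋r ≋-refl) (+P-inverseʳ r))

  infix 4 _≋?_
  _≋?_ : ∀ p r → Dec (p ≋ r)
  p ≋? r = map′ ≈P⇒≋ ≋⇒≈P (isZeroP? (p +P negP r))

  ℤ-rawRing : RawRing 0ℓ 0ℓ
  ℤ-rawRing = CommutativeRing.rawRing ℤ.+-*-commutativeRing

  integer-coefficient-≟ : ∀ {R : AlmostCommutativeRing 0ℓ 0ℓ} (φ : ℤ-rawRing -Raw-AlmostCommutative⟶ R) →
                          WeaklyDecidable (Induced-equivalence φ)
  integer-coefficient-≟ {R} φ a b with a ℤ.≟ b
  ... | yes refl = just (AlmostCommutativeRing.refl R)
  ... | no  _    = nothing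

  ℤ⟶Poly : ℤ-rawRing -Raw-AlmostCommutative⟶ fromCommutativeRing Poly-commutativeRing
  ℤ⟶Poly = record
    { ⟦_⟧    = _∷ []
    ; +-homo = λ _ _ → ≋-refl
    ; *-homo = λ a b → ∷-cong₂ (sym (ℤ.+-identityʳ (a * b))) ≋-refl
    ; -‿homo = λ _ → ≋-refl
    ; 0-homo = ∷-≋[] refl ≋-refl
    ; 1-homo = ≋-refl }

  *P-≋[]⇒≋[] : ∀ {a p} → a ≢ 0ℤ → ∀ r → (a ∷ p) *P r ≋ [] → r ≋ []
  *P-≋[]⇒≋[] a≢0 []      _     = ≋-refl
  *P-≋[]⇒≋[] {a} {p} a≢0 (b ∷ r) pr≋[] = ∷-≋[] b≡0 (*P-≋[]⇒≋[] {p = p} a≢0 r (tail-≋[] (begin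
    0ℤ ∷ (a ∷ p) *P r                         ≈⟨ +P-cong (scaleP-≡0 (a ∷ p) b≡0) ≋-refl ⟨
    scaleP b (a ∷ p) +P (0ℤ ∷ (a ∷ p) *P r)   ≈⟨ *P-∷ʳ (a ∷ p) b r ⟨
    (a ∷ p) *P (b ∷ r)                        ≈⟨ pr≋[] ⟩
    []                                        ∎)))
    where
    open ≋-Reasoning
    b≡0 : b ≡ 0ℤ
    b≡0 = [ flip contradiction a≢0 , id ]′
      (ℤ.i*j≡0⇒i≡0∨j≡0 a (trans (sym (coeff-*P-zero a p (b ∷ r))) (coeff-≡ pr≋[] zero)))

  *P-integral : ∀ p r → p *P r ≋ [] → p ≋ [] ⊎ r ≋ []
  *P-integral []      r _ = inj₁ ≋-refl
  *P-integral (a ∷ p) r pr≋[] with a ℤ.≟ 0ℤ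
  ... | yes a≡0 = Sum.map₁ (∷-≋[] a≡0) (*P-integral p r (tail-≋[] (≋-trans (≋-sym (∷-*P-≡0 p r a≡0)) pr≋[])))
  ... | no  a≢0 = inj₂ (*P-≋[]⇒≋[] {p = p} a≢0 r pr≋[])

module Poly-Solver = RingSolver ℤ-rawRing (fromCommutativeRing Poly-commutativeRing) ℤ⟶Poly
                                (integer-coefficient-≟ ℤ⟶Poly)

*P-nonzero : ∀ {p r} → ¬ IsZeroP p → ¬ IsZeroP r → ¬ IsZeroP (p *P r)
*P-nonzero {p} {r} p≉0 r≉0 pr≈0 with *P-integral p r (IsZeroP⇒≋[] pr≈0)
... | inj₁ p≋[] = p≉0 (≋[]⇒IsZeroP p p≋[])
... | inj₂ r≋[] = r≉0 (≋[]⇒IsZeroP r r≋[])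

*P-cancelʳ : ∀ {p r} c → ¬ IsZeroP c → p *P c ≋ r *P c → p ≋ r
*P-cancelʳ {p} {r} c c≉0 pc≋rc with *P-integral (p +P negP r) c (begin
    (p +P negP r) *P c        ≈⟨ solve 3 (λ p r c → (p :+ :- r) :* c := p :* c :+ :- (r :* c)) ≋-refl p r c ⟩
    p *P c +P negP (r *P c)   ≈⟨ +P-cong pc≋rc ≋-refl ⟩
    r *P c +P negP (r *P c)   ≈⟨ +P-inverseʳ (r *P c) ⟩
    []                        ∎)
  where open ≋-Reasoning
        open Poly-Solver using (solve; _:+_; _:*_; :-_; _:=_)
... | inj₂ c≋[]   = contradiction (≋[]⇒IsZeroP c c≋[]) c≉0
... | inj₁ p-r≋[] = begin
    p                         ≈⟨ solve 2 (λ p r → p := (p :+ :- r) :+ r) ≋-refl p r ⟩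
    (p +P negP r) +P r        ≈⟨ +P-cong p-r≋[] ≋-refl ⟩
    r                         ∎
  where open ≋-Reasoning
        open Poly-Solver using (solve; _:+_; :-_; _:=_)

-- The field of fractions ℚ(q)

infix 4 _≈_
record _≈_ (x y : RF) : Set where
  constructor mk≈
  field cross : num x *P den y ≋ num y *P den x
open _≈_

≈F⇒≈ : ∀ {x y} → x ≈F y → x ≈ y
≈F⇒≈ x≈y = mk≈ (≈P⇒≋ x≈y)

≈⇒≈F : ∀ {x y} → x ≈ y → x ≈F y
≈⇒≈F x≈y = ≋⇒≈P (cross x≈y)

infix 4 _≈?_
_≈?_ : ∀ x y → Dec (x ≈ y)
x ≈? y = map′ mk≈ cross (num x *P den y ≋? num y *P den x)

≈-refl : ∀ {x} → x ≈ x
≈-refl = mk≈ ≋-refl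

≈-sym : ∀ {x y} → x ≈ y → y ≈ x
≈-sym x≈y = mk≈ (≋-sym (cross x≈y))

≈-trans : ∀ {x y z} → x ≈ y → y ≈ z → x ≈ z
≈-trans {x} {y} {z} x≈y y≈z = mk≈ (*P-cancelʳ (den y) (den≠0 y) (begin
  (num x *P den z) *P den y  ≈⟨ swap (num x) (den z) (den y) ⟩
  (num x *P den y) *P den z  ≈⟨ *P-cong (cross x≈y) ≋-refl ⟩
  (num y *P den x) *P den z  ≈⟨ swap (num y) (den x) (den z) ⟩
  (num y *P den z) *P den x  ≈⟨ *P-cong (cross y≈z) ≋-refl ⟩
  (num z *P den y) *P den x  ≈⟨ swap (num z) (den y) (den x) ⟩
  (num z *P den x) *P den y  ∎))
  where
  open ≋-Reasoning
  open Poly-Solver using (solve; _:*_; _:=_)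
  swap : ∀ a b c → (a *P b) *P c ≋ (a *P c) *P b
  swap = solve 3 (λ a b c → (a :* b) :* c := (a :* c) :* b) ≋-refl

≈-isEquivalence : IsEquivalence _≈_
≈-isEquivalence = record { refl = ≈-refl ; sym = ≈-sym ; trans = ≈-trans }

-- Through _≐_∕_ every field law below becomes a polynomial identity in ℤ[q].
infix 4 _≐_∕_
record _≐_∕_ (x : RF) (a b : Poly) : Set where
  constructor _,_
  field
    num-≋ : num x ≋ a
    den-≋ : den x ≋ b

≐-num∕den : ∀ x → x ≐ num x ∕ den x
≐-num∕den x = ≋-refl , ≋-refl

mkRF-≐ : ∀ a b → ¬ IsZeroP b → mkRF a b ≐ a ∕ b
mkRF-≐ a b b≉0 with isZeroP? b
... | yes b≈0 = contradiction b≈0 b≉0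
... | no  _   = ≋-refl , ≋-refl

≐-+F : ∀ {x y a b c e} → x ≐ a ∕ b → y ≐ c ∕ e → x +F y ≐ a *P e +P c *P b ∕ b *P e
≐-+F {x} {y} (a , b) (c , e) with mkRF-≐ (num x *P den y +P num y *P den x) (den x *P den y)
                                         (*P-nonzero (den≠0 x) (den≠0 y))
... | n , d = ≋-trans n (+P-cong (*P-cong a e) (*P-cong c b)) , ≋-trans d (*P-cong b e)

≐-*F : ∀ {x y a b c e} → x ≐ a ∕ b → y ≐ c ∕ e → x *F y ≐ a *P c ∕ b *P e
≐-*F {x} {y} (a , b) (c , e) with mkRF-≐ (num x *P num y) (den x *P den y)
                                         (*P-nonzero (den≠0 x) (den≠0 y))
... | n , d = ≋-trans n (*P-cong a c) , ≋-trans d (*P-cong b e)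

≐-neg : ∀ {x a b} → x ≐ a ∕ b → -F x ≐ negP a ∕ b
≐-neg (a , b) = negP-cong a , b

≐-0F : 0F ≐ ℤ.0ℤ ∷ [] ∕ ℤ.1ℤ ∷ []
≐-0F = ≋-sym (∷-≋[] ≡.refl ≋-refl) , ≋-refl

≈-by-cross : ∀ {x y a b c e} → x ≐ a ∕ b → y ≐ c ∕ e → a *P e ≋ c *P b → x ≈ y
≈-by-cross (a , b) (c , e) ae≋cb =
  mk≈ (≋-trans (*P-cong a e) (≋-trans ae≋cb (≋-sym (*P-cong c b))))

module _ where
  open import Data.Integer using (0ℤ; 1ℤ)
  open Poly-Solver using (solve; _:+_; _:*_; :-_; _:=_; con)

  +F-cong : ∀ {x x′ y y′} → x ≈ x′ → y ≈ y′ → x +F y ≈ x′ +F y′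
  +F-cong {x} {x′} {y} {y′} x≈ y≈ =
    ≈-by-cross (≐-+F (≐-num∕den x) (≐-num∕den y)) (≐-+F (≐-num∕den x′) (≐-num∕den y′)) (begin
      (a *P e +P c *P b) *P (b′ *P e′)                    ≈⟨ solve 6 (λ a b c e b′ e′ →
                                                              (a :* e :+ c :* b) :* (b′ :* e′) :=
                                                              (a :* b′) :* (e :* e′) :+ (c :* e′) :* (b :* b′))
                                                            ≋-refl a b c e b′ e′ ⟩
      (a *P b′) *P (e *P e′) +P (c *P e′) *P (b *P b′)    ≈⟨ +P-cong (*P-cong (cross x≈) ≋-refl)
                                                                     (*P-cong (cross y≈) ≋-refl) ⟩
      (a′ *P b) *P (e *P e′) +P (c′ *P e) *P (b *P b′)    ≈⟨ solve 6 (λ a′ b c′ e b′ e′ →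
                                                              (a′ :* b) :* (e :* e′) :+ (c′ :* e) :* (b :* b′) :=
                                                              (a′ :* e′ :+ c′ :* b′) :* (b :* e))
                                                            ≋-refl a′ b c′ e b′ e′ ⟩
      (a′ *P e′ +P c′ *P b′) *P (b *P e)                  ∎)
    where
    open ≋-Reasoning
    a = num x ; b = den x ; c = num y ; e = den y
    a′ = num x′ ; b′ = den x′ ; c′ = num y′ ; e′ = den y′

  *F-cong : ∀ {x x′ y y′} → x ≈ x′ → y ≈ y′ → x *F y ≈ x′ *F y′
  *F-cong {x} {x′} {y} {y′} x≈ y≈ =
    ≈-by-cross (≐-*F (≐-num∕den x) (≐-num∕den y)) (≐-*F (≐-num∕den x′) (≐-num∕den y′)) (begin
      (a *P c) *P (b′ *P e′)   ≈⟨ solve 4 (λ a c b′ e′ → (a :* c) :* (b′ :* e′) := (a :* b′) :* (c :* e′))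
                                    ≋-refl a c b′ e′ ⟩
      (a *P b′) *P (c *P e′)   ≈⟨ *P-cong (cross x≈) (cross y≈) ⟩
      (a′ *P b) *P (c′ *P e)   ≈⟨ solve 4 (λ a′ b c′ e → (a′ :* b) :* (c′ :* e) := (a′ :* c′) :* (b :* e))
                                    ≋-refl a′ b c′ e ⟩
      (a′ *P c′) *P (b *P e)   ∎)
    where
    open ≋-Reasoning
    a = num x ; b = den x ; c = num y ; e = den y
    a′ = num x′ ; b′ = den x′ ; c′ = num y′ ; e′ = den y′

  -F-cong : ∀ {x x′} → x ≈ x′ → -F x ≈ -F x′
  -F-cong {x} {x′} x≈ = ≈-by-cross (≐-neg (≐-num∕den x)) (≐-neg (≐-num∕den x′)) (begin
    negP (num x) *P den x′    ≈⟨ solve 2 (λ a b → (:- a) :* b := :- (a :* b)) ≋-refl (num x) (den x′) ⟩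
    negP (num x *P den x′)    ≈⟨ negP-cong (cross x≈) ⟩
    negP (num x′ *P den x)    ≈⟨ solve 2 (λ a b → :- (a :* b) := (:- a) :* b) ≋-refl (num x′) (den x) ⟩
    negP (num x′) *P den x    ∎)
    where open ≋-Reasoning

  +F-comm : ∀ x y → x +F y ≈ y +F x
  +F-comm x y = ≈-by-cross (≐-+F (≐-num∕den x) (≐-num∕den y)) (≐-+F (≐-num∕den y) (≐-num∕den x))
    (solve 4 (λ a b c e → (a :* e :+ c :* b) :* (e :* b) := (c :* b :+ a :* e) :* (b :* e))
           ≋-refl (num x) (den x) (num y) (den y))

  +F-assoc : ∀ x y z → (x +F y) +F z ≈ x +F (y +F z)
  +F-assoc x y z =
    ≈-by-cross (≐-+F (≐-+F (≐-num∕den x) (≐-num∕den y)) (≐-num∕den z))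
               (≐-+F (≐-num∕den x) (≐-+F (≐-num∕den y) (≐-num∕den z)))
      (solve 6 (λ a b c e f g → ((a :* e :+ c :* b) :* g :+ f :* (b :* e)) :* (b :* (e :* g)) :=
                                (a :* (e :* g) :+ (c :* g :+ f :* e) :* b) :* ((b :* e) :* g))
             ≋-refl (num x) (den x) (num y) (den y) (num z) (den z))

  +F-identityˡ : ∀ x → 0F +F x ≈ x
  +F-identityˡ x = ≈-by-cross (≐-+F ≐-0F (≐-num∕den x)) (≐-num∕den x)
    (solve 2 (λ a b → (con 0ℤ :* b :+ a :* con 1ℤ) :* b := a :* (con 1ℤ :* b))
           ≋-refl (num x) (den x))

  +F-inverseˡ : ∀ x → -F x +F x ≈ 0F
  +F-inverseˡ x = ≈-by-cross (≐-+F (≐-neg (≐-num∕den x)) (≐-num∕den x)) ≐-0F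
    (solve 2 (λ a b → ((:- a) :* b :+ a :* b) :* con 1ℤ := con 0ℤ :* (b :* b))
           ≋-refl (num x) (den x))

  *F-comm : ∀ x y → x *F y ≈ y *F x
  *F-comm x y = ≈-by-cross (≐-*F (≐-num∕den x) (≐-num∕den y)) (≐-*F (≐-num∕den y) (≐-num∕den x))
    (solve 4 (λ a b c e → (a :* c) :* (e :* b) := (c :* a) :* (b :* e))
           ≋-refl (num x) (den x) (num y) (den y))

  *F-assoc : ∀ x y z → (x *F y) *F z ≈ x *F (y *F z)
  *F-assoc x y z =
    ≈-by-cross (≐-*F (≐-*F (≐-num∕den x) (≐-num∕den y)) (≐-num∕den z))
               (≐-*F (≐-num∕den x) (≐-*F (≐-num∕den y) (≐-num∕den z)))
      (solve 6 (λ a b c e f g → ((a :* c) :* f) :* (b :* (e :* g)) := (a :* (c :* f)) :* ((b :* e) :* g))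
             ≋-refl (num x) (den x) (num y) (den y) (num z) (den z))

  *F-identityˡ : ∀ x → 1F *F x ≈ x
  *F-identityˡ x = ≈-by-cross (≐-*F (≐-num∕den 1F) (≐-num∕den x)) (≐-num∕den x)
    (solve 2 (λ a b → (con 1ℤ :* a) :* b := a :* (con 1ℤ :* b)) ≋-refl (num x) (den x))

  *F-distribʳ : ∀ z x y → (x +F y) *F z ≈ x *F z +F y *F z
  *F-distribʳ z x y =
    ≈-by-cross (≐-*F (≐-+F (≐-num∕den x) (≐-num∕den y)) (≐-num∕den z))
               (≐-+F (≐-*F (≐-num∕den x) (≐-num∕den z)) (≐-*F (≐-num∕den y) (≐-num∕den z)))
      (solve 6 (λ a b c e f g → ((a :* e :+ c :* b) :* f) :* ((b :* g) :* (e :* g)) :=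
                                ((a :* f) :* (e :* g) :+ (c :* f) :* (b :* g)) :* ((b :* e) :* g))
             ≋-refl (num x) (den x) (num y) (den y) (num z) (den z))

RF-commutativeRing : CommutativeRing 0ℓ 0ℓ
RF-commutativeRing = record
  { Carrier = RF ; _≈_ = _≈_ ; _+_ = _+F_ ; _*_ = _*F_ ; -_ = -F_ ; 0# = 0F ; 1# = 1F
  ; isCommutativeRing = record
    { isRing = record
      { +-isAbelianGroup = record
        { isGroup = record
          { isMonoid = record
            { isSemigroup = record
              { isMagma = record { isEquivalence = ≈-isEquivalence ; ∙-cong = +F-cong }
              ; assoc = +F-assoc }
            ; identity = +F-identityˡ , λ x → ≈-trans (+F-comm x 0F) (+F-identityˡ x) }
          ; inverse = +F-inverseˡ , λ x → ≈-trans (+F-comm x (-F x)) (+F-inverseˡ x)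
          ; ⁻¹-cong = -F-cong }
        ; comm = +F-comm }
      ; *-cong = *F-cong
      ; *-assoc = *F-assoc
      ; *-identity = *F-identityˡ , λ x → ≈-trans (*F-comm x 1F) (*F-identityˡ x)
      ; distrib = (λ x y z → ≈-trans (*F-comm x (y +F z))
                               (≈-trans (*F-distribʳ x y z) (+F-cong (*F-comm y x) (*F-comm z x))))
                , *F-distribʳ }
    ; *-comm = *F-comm } }

module ≈-Reasoning = SetoidReasoning (CommutativeRing.setoid RF-commutativeRing)

+F-congˡ : ∀ x {y y′} → y ≈ y′ → x +F y ≈ x +F y′
+F-congˡ x = +F-cong (≈-refl {x})

*F-congˡ : ∀ x {y y′} → y ≈ y′ → x *F y ≈ x *F y′
*F-congˡ x = *F-cong (≈-refl {x})

*F-congʳ : ∀ y {x x′} → x ≈ x′ → x *F y ≈ x′ *F y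
*F-congʳ y x≈ = *F-cong x≈ (≈-refl {y})

q^ : ℕ → RF
q^ n = fromPoly (qPolyPow n)

-- The quantum integer [k]_i = (q_iᵏ − q_i⁻ᵏ) / (q_i − q_i⁻¹), where q_i = q^(d i).
infix 10 [_]_
[_]_ : ℕ → I → RF
[ zero  ] i = 0F
[ suc k ] i = qpow (d i ℤ.* ℤ.+ k) +F qpow (ℤ.- d i) *F [ k ] i

infix 9 _⁻¹
_⁻¹ : (x : RF) → {True (¬? (isZeroP? (num x)))} → RF
(x ⁻¹) {num≉0} = den x / num x ⟨ toWitness num≉0 ⟩

-- The action of U_q(G₂) on V(Λ₁) ⊗ V(Λ₁)

open FormalCombinations RF-commutativeRing
open CommutativeRing RF-commutativeRing using (zeroˡ; zeroʳ; +-identityʳ; +-abelianGroup)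
open import Algebra.Properties.AbelianGroup +-abelianGroup using (⁻¹-anti-homo‿-; xyx⁻¹≈y)

eRow : I → G → Sparse₁
eRow i1 g1  = (1F , g2) ∷ []
eRow i1 g3  = (qint2 , g0) ∷ []
eRow i1 g0  = (1F , g3') ∷ []
eRow i1 g2' = (1F , g1') ∷ []
eRow i2 g2  = (1F , g3) ∷ []
eRow i2 g3' = (1F , g2') ∷ []
eRow _  _   = []

fRow : I → G → Sparse₁
fRow i1 g2  = (1F , g1) ∷ []
fRow i1 g0  = (1F , g3) ∷ []
fRow i1 g3' = (qint2 , g0) ∷ []
fRow i1 g1' = (1F , g2') ∷ []
fRow i2 g3  = (1F , g2) ∷ []
fRow i2 g2' = (1F , g3') ∷ []
fRow _  _   = []

⟨single⟩₁ : ∀ k x u → k *F u x ≈ ⟨ (k , x) ∷ [] ∣ u ⟩₁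
⟨single⟩₁ k x u = ≈-sym (+-identityʳ (k *F u x))

⟨unit⟩₁ : ∀ x u → u x ≈ ⟨ (1F , x) ∷ [] ∣ u ⟩₁
⟨unit⟩₁ x u = ≈-trans (≈-sym (*F-identityˡ (u x))) (⟨single⟩₁ 1F x u)

eV-row : ∀ i u x → eV i u x ≈ ⟨ eRow i x ∣ u ⟩₁
eV-row i1 u g1  = ⟨unit⟩₁ g2 u
eV-row i1 u g2  = ≈-refl
eV-row i1 u g3  = ⟨single⟩₁ qint2 g0 u
eV-row i1 u g0  = ⟨unit⟩₁ g3' u
eV-row i1 u g3' = ≈-refl
eV-row i1 u g2' = ⟨unit⟩₁ g1' u
eV-row i1 u g1' = ≈-refl
eV-row i2 u g1  = ≈-refl
eV-row i2 u g2  = ⟨unit⟩₁ g3 u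
eV-row i2 u g3  = ≈-refl
eV-row i2 u g0  = ≈-refl
eV-row i2 u g3' = ⟨unit⟩₁ g2' u
eV-row i2 u g2' = ≈-refl
eV-row i2 u g1' = ≈-refl

fV-row : ∀ i u x → fV i u x ≈ ⟨ fRow i x ∣ u ⟩₁
fV-row i1 u g1  = ≈-refl
fV-row i1 u g2  = ⟨unit⟩₁ g1 u
fV-row i1 u g3  = ≈-refl
fV-row i1 u g0  = ⟨unit⟩₁ g3 u
fV-row i1 u g3' = ⟨single⟩₁ qint2 g0 u
fV-row i1 u g2' = ≈-refl
fV-row i1 u g1' = ⟨unit⟩₁ g2' u
fV-row i2 u g1  = ≈-refl
fV-row i2 u g2  = ≈-refl
fV-row i2 u g3  = ⟨unit⟩₁ g2 u
fV-row i2 u g0  = ≈-refl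
fV-row i2 u g3' = ≈-refl
fV-row i2 u g2' = ⟨unit⟩₁ g3' u
fV-row i2 u g1' = ≈-refl

E-row : I → G → G → Sparse
E-row i x y = qpow (ℤ.- (d i ℤ.* m i y)) ⊙ eRow i x ⊗ˡ y ++ x ⊗ʳ eRow i y

E-rows : ∀ i → Rows (E2 i) (E-row i)
E-rows i w x y = begin
  eV i (λ x′ → w x′ y) x *F k +F eV i (w x) y
    ≈⟨ +F-cong (≈-trans (*F-comm (eV i (λ x′ → w x′ y) x) k) (*F-congˡ k (eV-row i (λ x′ → w x′ y) x)))
               (eV-row i (w x) y) ⟩
  k *F ⟨ eRow i x ∣ (λ x′ → w x′ y) ⟩₁ +F ⟨ eRow i y ∣ w x ⟩₁
    ≈⟨ +F-cong (≈-trans (⟨⊙⟩ k (eRow i x ⊗ˡ y) w) (*F-congˡ k (⟨⊗ˡ⟩ (eRow i x) y w)))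
               (⟨⊗ʳ⟩ x (eRow i y) w) ⟨
  ⟨ k ⊙ eRow i x ⊗ˡ y ∣ w ⟩ +F ⟨ x ⊗ʳ eRow i y ∣ w ⟩
    ≈⟨ ⟨⟩-++ (k ⊙ eRow i x ⊗ˡ y) (x ⊗ʳ eRow i y) w ⟨
  ⟨ E-row i x y ∣ w ⟩ ∎
  where
  open ≈-Reasoning
  k = qpow (ℤ.- (d i ℤ.* m i y))

F-row : I → G → G → Sparse
F-row i x y = fRow i x ⊗ˡ y ++ qpow (d i ℤ.* m i x) ⊙ x ⊗ʳ fRow i y

F-rows : ∀ i → Rows (F2 i) (F-row i)
F-rows i w x y = begin
  fV i (λ x′ → w x′ y) x +F k *F fV i (w x) y
    ≈⟨ +F-cong (fV-row i (λ x′ → w x′ y) x) (*F-congˡ k (fV-row i (w x) y)) ⟩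
  ⟨ fRow i x ∣ (λ x′ → w x′ y) ⟩₁ +F k *F ⟨ fRow i y ∣ w x ⟩₁
    ≈⟨ +F-cong (⟨⊗ˡ⟩ (fRow i x) y w)
               (≈-trans (⟨⊙⟩ k (x ⊗ʳ fRow i y) w) (*F-congˡ k (⟨⊗ʳ⟩ x (fRow i y) w))) ⟨
  ⟨ fRow i x ⊗ˡ y ∣ w ⟩ +F ⟨ k ⊙ x ⊗ʳ fRow i y ∣ w ⟩
    ≈⟨ ⟨⟩-++ (fRow i x ⊗ˡ y) (k ⊙ x ⊗ʳ fRow i y) w ⟨
  ⟨ F-row i x y ∣ w ⟩ ∎
  where
  open ≈-Reasoning
  k = qpow (d i ℤ.* m i x)

T-row : I → G → G → Sparse
T-row i x y = (qpow (d i ℤ.* (m i x ℤ.+ m i y)) , x , y) ∷ []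

T-rows : ∀ i → Rows (T2 i) (T-row i)
T-rows i w x y = ≈-sym (+-identityʳ (qpow (d i ℤ.* (m i x ℤ.+ m i y)) *F w x y))

T⁻¹-row : I → G → G → Sparse
T⁻¹-row i x y = (qpow (ℤ.- (d i ℤ.* (m i x ℤ.+ m i y))) , x , y) ∷ []

T⁻¹-rows : ∀ i → Rows (Tinv2 i) (T⁻¹-row i)
T⁻¹-rows i w x y = ≈-sym (+-identityʳ (qpow (ℤ.- (d i ℤ.* (m i x ℤ.+ m i y))) *F w x y))

-- Linear independence

-- π a b is the linear form on V(Λ₁) ⊗ V(Λ₁) inducing the v_(a,b)-coordinate on
-- W(Λ₂) = V(Λ₁) ⊗ V(Λ₁) / N.
π : G → G → Sparse
π g1 g2   = (1F , g1 , g2) ∷ (-F q^ 1 , g2 , g1) ∷ []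
π g1 g3   = (1F , g1 , g3) ∷ (-F q^ 1 , g3 , g1) ∷ []
π g1 g0   = (1F , g1 , g0) ∷ (-F q^ 2 , g0 , g1) ∷ []
π g1 g3'  = (1F , g1 , g3') ∷ (-F q^ 3 , g3' , g1) ∷ []
π g1 g2'  = (1F , g1 , g2') ∷ (-F q^ 3 , g2' , g1) ∷ []
π g1 g1'  = (1F , g1 , g1') ∷ (-F q^ 4 , g1' , g1) ∷ []
π g2 g3   = (1F , g2 , g3) ∷ (-F q^ 3 , g3 , g2) ∷ (q^ 5 -F q^ 1 , g0 , g1) ∷ []
π g2 g0   = (1F , g2 , g0) ∷ (-F q^ 2 , g0 , g2) ∷ (q^ 3 -F q^ 1 , g3' , g1) ∷ []
π g2 g3'  = (1F , g2 , g3') ∷ (-F q^ 1 , g3' , g2) ∷ []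
π g2 g2'  = (1F , g2 , g2') ∷ (-F q^ 4 , g2' , g2) ∷ (q^ 5 -F q^ 3 , g1' , g1) ∷ []
π g2 g1'  = (1F , g2 , g1') ∷ (-F q^ 3 , g1' , g2) ∷ []
π g3 g0   = (1F , g3 , g0) ∷ (-F q^ 2 , g0 , g3) ∷ (q^ 3 -F q^ 1 , g2' , g1) ∷ []
π g3 g3'  = (1F , g3 , g3') ∷ (-F q^ 4 , g3' , g3) ∷ (q^ 7 -F q^ 1 , g2' , g2) ∷ (q^ 6 -F q^ 8 , g1' , g1) ∷ []
π g3 g2'  = (1F , g3 , g2') ∷ (-F q^ 1 , g2' , g3) ∷ []
π g3 g1'  = (1F , g3 , g1') ∷ (-F q^ 3 , g1' , g3) ∷ []
π g0 g0   = (1F , g0 , g0) ∷ (-F q^ 1 , g3' , g3) ∷ (q^ 4 , g2' , g2) ∷ (q^ 3 -F q^ 1 -F q^ 5 , g1' , g1) ∷ []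
π g0 g3'  = (1F , g0 , g3') ∷ (-F q^ 2 , g3' , g0) ∷ (q^ 3 -F q^ 1 , g1' , g2) ∷ []
π g0 g2'  = (1F , g0 , g2') ∷ (-F q^ 2 , g2' , g0) ∷ (q^ 3 -F q^ 1 , g1' , g3) ∷ []
π g0 g1'  = (1F , g0 , g1') ∷ (-F q^ 2 , g1' , g0) ∷ []
π g3' g2' = (1F , g3' , g2') ∷ (-F q^ 3 , g2' , g3') ∷ (q^ 5 -F q^ 1 , g1' , g0) ∷ []
π g3' g1' = (1F , g3' , g1') ∷ (-F q^ 1 , g1' , g3') ∷ []
π g2' g1' = (1F , g2' , g1') ∷ (-F q^ 1 , g1' , g2') ∷ []
π _ _     = []

Closed : (G → G → Sparse) → Set
Closed M = ∀ a b x y → dense (π a b ▷ M) x y ≈ dense (π a b ▷ M ▷ π) x y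

closed? : ∀ M → Dec (Closed M)
closed? M = ∀G? λ a → ∀G? λ b → ∀G? λ x → ∀G? λ y →
  dense (π a b ▷ M) x y ≈? dense (π a b ▷ M ▷ π) x y

E-closed : ∀ i → Closed (E-row i)
E-closed = from-yes (∀I? λ i → closed? (E-row i))

F-closed : ∀ i → Closed (F-row i)
F-closed = from-yes (∀I? λ i → closed? (F-row i))

T-closed : ∀ i → Closed (T-row i)
T-closed = from-yes (∀I? λ i → closed? (T-row i))

T⁻¹-closed : ∀ i → Closed (T⁻¹-row i)
T⁻¹-closed = from-yes (∀I? λ i → closed? (T⁻¹-row i))

π-vanishes-on-generator : ∀ a b → ⟨ π a b ∣ vv g1 g1 ⟩ ≈ 0F
π-vanishes-on-generator = from-yes (∀G? λ a → ∀G? λ b → ⟨ π a b ∣ vv g1 g1 ⟩ ≈? 0F)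

π-vanishes-on-N : ∀ {w} → InN w → ∀ a b → ⟨ π a b ∣ w ⟩ ≈ 0F
π-vanishes-on-N gen                  = π-vanishes-on-generator
π-vanishes-on-N (add {w} {w′} p p′) a b =
  ≈-trans (⟨⟩-+ (π a b) w w′)
          (≈-trans (+F-cong (π-vanishes-on-N p a b) (π-vanishes-on-N p′ a b)) (+F-identityˡ 0F))
π-vanishes-on-N (scale {w} c p)      a b =
  ≈-trans (⟨⟩-*ˡ (π a b) c w) (≈-trans (*F-congˡ c (π-vanishes-on-N p a b)) (zeroʳ c))
π-vanishes-on-N (resp w≈w′ p)        a b =
  ≈-trans (⟨⟩-cong (π a b) (λ x y → ≈-sym (≈F⇒≈ (w≈w′ x y)))) (π-vanishes-on-N p a b)
π-vanishes-on-N (actE i p)    = kernel-stable (E-rows i) π (E-closed i) (π-vanishes-on-N p)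
π-vanishes-on-N (actF i p)    = kernel-stable (F-rows i) π (F-closed i) (π-vanishes-on-N p)
π-vanishes-on-N (actT i p)    = kernel-stable (T-rows i) π (T-closed i) (π-vanishes-on-N p)
π-vanishes-on-N (actTinv i p) = kernel-stable (T⁻¹-rows i) π (T⁻¹-closed i) (π-vanishes-on-N p)

π-dual : ∀ a b x y → IsColumn a b → IsColumn x y → dense (π a b) x y ≈ δᴳ a x *F δᴳ b y
π-dual = from-yes (∀G? λ a → ∀G? λ b → ∀G? λ x → ∀G? λ y →
  isColumn? a b →-dec (isColumn? x y →-dec (dense (π a b) x y ≈? δᴳ a x *F δᴳ b y)))

⟨π⟩-column : ∀ {a b} → IsColumn a b → ∀ w → (∀ x y → ¬ IsColumn x y → w x y ≈ 0F) →
             ⟨ π a b ∣ w ⟩ ≈ w a b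
⟨π⟩-column {a} {b} ab w w-off = ⟨⟩-coordinate (π a b) w a b agree
  where
  agree : ∀ x y → dense (π a b) x y *F w x y ≈ δᴳ a x *F (δᴳ b y *F w x y)
  agree x y with isColumn? x y
  ... | yes xy = ≈-trans (*F-congʳ (w x y) (π-dual a b x y ab xy)) (*F-assoc (δᴳ a x) (δᴳ b y) (w x y))
  ... | no ¬xy = begin
    dense (π a b) x y *F w x y   ≈⟨ *F-congˡ (dense (π a b) x y) (w-off x y ¬xy) ⟩
    dense (π a b) x y *F 0F      ≈⟨ zeroʳ (dense (π a b) x y) ⟩
    0F                           ≈⟨ zeroʳ (δᴳ a x *F δᴳ b y) ⟨
    (δᴳ a x *F δᴳ b y) *F 0F     ≈⟨ *F-assoc (δᴳ a x) (δᴳ b y) 0F ⟩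
    δᴳ a x *F (δᴳ b y *F 0F)     ≈⟨ *F-congˡ (δᴳ a x) (*F-congˡ (δᴳ b y) (w-off x y ¬xy)) ⟨
    δᴳ a x *F (δᴳ b y *F w x y)  ∎
    where open ≈-Reasoning

IsColumn-irrelevant : ∀ {a b} (p p′ : IsColumn a b) → p ≡ p′
IsColumn-irrelevant (inj₁ a≺b)         (inj₁ a≺b′)        = ≡.cong inj₁ (<-irrelevant a≺b a≺b′)
IsColumn-irrelevant (inj₁ a≺b)         (inj₂ (≡.refl , ≡.refl)) = contradiction a≺b (<-irrefl ≡.refl)
IsColumn-irrelevant (inj₂ (≡.refl , ≡.refl)) (inj₁ a≺b)         = contradiction a≺b (<-irrefl ≡.refl)
IsColumn-irrelevant (inj₂ (≡.refl , ≡.refl)) (inj₂ (≡.refl , ≡.refl)) = ≡.refl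

comb-on-column : ∀ c x y (p : IsColumn x y) → comb c x y ≈ c x y p
comb-on-column c x y p with isColumn? x y
... | yes p′ rewrite IsColumn-irrelevant p p′ = ≈-refl
... | no ¬p = contradiction p ¬p

comb-off-column : ∀ c x y → ¬ IsColumn x y → comb c x y ≈ 0F
comb-off-column c x y ¬p with isColumn? x y
... | yes p = contradiction p ¬p
... | no _  = ≈-refl

independence : (c : Coeffs) → InN (comb c) → (a b : G) (p : IsColumn a b) → c a b p ≈F 0F
independence c c∈N a b p = ≈⇒≈F (begin
  c a b p              ≈⟨ comb-on-column c a b p ⟨
  comb c a b           ≈⟨ ⟨π⟩-column p (comb c) (comb-off-column c) ⟨
  ⟨ π a b ∣ comb c ⟩   ≈⟨ π-vanishes-on-N c∈N a b ⟩
  0F                   ∎)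
  where open ≈-Reasoning

-- Spanning

-- For (x , y) not a column, N-element x y lies in N and its only coordinate
-- outside the columns is 1 at v_x ⊗ v_y; for a column it is 0.
N-element : G → G → Sparse
N-element g1 g1   = (1F , g1 , g1) ∷ []
N-element g2 g1   = (1F , g2 , g1) ∷ (q^ 1 , g1 , g2) ∷ []
N-element g2 g2   = (1F , g2 , g2) ∷ []
N-element g3 g1   = (1F , g3 , g1) ∷ (q^ 1 , g1 , g3) ∷ []
N-element g3 g2   = (1F , g3 , g2) ∷ (q^ 3 , g2 , g3) ∷ []
N-element g3 g3   = (1F , g3 , g3) ∷ []
N-element g0 g1   = (1F , g0 , g1) ∷ (q^ 2 , g1 , g0) ∷ (q^ 1 -F q^ 5 , g2 , g3) ∷ []
N-element g0 g2   = (1F , g0 , g2) ∷ (q^ 2 , g2 , g0) ∷ []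
N-element g0 g3   = (1F , g0 , g3) ∷ (q^ 2 , g3 , g0) ∷ []
N-element g3' g1  = (1F , g3' , g1) ∷ (q^ 3 , g1 , g3') ∷ (q^ 1 -F q^ 3 , g2 , g0) ∷ []
N-element g3' g2  = (1F , g3' , g2) ∷ (q^ 1 , g2 , g3') ∷ []
N-element g3' g3  = (1F , g3' , g3) ∷ (q^ 4 , g3 , g3') ∷ (q^ 1 , g0 , g0) ∷ []
N-element g3' g0  = (1F , g3' , g0) ∷ (q^ 2 , g0 , g3') ∷ []
N-element g3' g3' = (1F , g3' , g3') ∷ []
N-element g2' g1  = (1F , g2' , g1) ∷ (q^ 3 , g1 , g2') ∷ (q^ 1 -F q^ 3 , g3 , g0) ∷ []
N-element g2' g2  = (1F , g2' , g2) ∷ (q^ 4 , g2 , g2') ∷ (q^ 1 -F q^ 7 , g3 , g3') ∷ (-F q^ 4 , g0 , g0) ∷ []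
N-element g2' g3  = (1F , g2' , g3) ∷ (q^ 1 , g3 , g2') ∷ []
N-element g2' g0  = (1F , g2' , g0) ∷ (q^ 2 , g0 , g2') ∷ []
N-element g2' g3' = (1F , g2' , g3') ∷ (q^ 3 , g3' , g2') ∷ []
N-element g2' g2' = (1F , g2' , g2') ∷ []
N-element g1' g1  = (1F , g1' , g1) ∷ (q^ 4 , g1 , g1') ∷ (q^ 3 -F q^ 5 , g2 , g2') ∷ (q^ 8 -F q^ 6 , g3 , g3')
                    ∷ (q^ 1 +F q^ 5 -F q^ 3 , g0 , g0) ∷ []
N-element g1' g2  = (1F , g1' , g2) ∷ (q^ 3 , g2 , g1') ∷ (q^ 1 -F q^ 3 , g0 , g3') ∷ []
N-element g1' g3  = (1F , g1' , g3) ∷ (q^ 3 , g3 , g1') ∷ (q^ 1 -F q^ 3 , g0 , g2') ∷ []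
N-element g1' g0  = (1F , g1' , g0) ∷ (q^ 2 , g0 , g1') ∷ (q^ 1 -F q^ 5 , g3' , g2') ∷ []
N-element g1' g3' = (1F , g1' , g3') ∷ (q^ 1 , g3' , g1') ∷ []
N-element g1' g2' = (1F , g1' , g2') ∷ (q^ 1 , g2' , g1') ∷ []
N-element g1' g1' = (1F , g1' , g1') ∷ []
N-element _ _     = []

n : G → G → V2
n x y = dense (N-element x y)

zero∈N : InN (λ _ _ → 0F)
zero∈N = resp (λ x y → ≈⇒≈F (zeroˡ (vv g1 g1 x y))) (scale 0F gen)

by-decision : ∀ {w w′} → InN w → {True (∀G? λ x → ∀G? λ y → w x y ≈? w′ x y)} → InN w′
by-decision w∈N {w≈w′} = resp (λ x y → ≈⇒≈F (toWitness w≈w′ x y)) w∈N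

-- Each element is obtained from earlier ones by f₁ or f₂ and rescaling; its
-- coordinates are checked against the table by computation.
n-g1-g1∈N : InN (n g1 g1)
n-g1-g1∈N = by-decision gen

n-g2-g1∈N : InN (n g2 g1)
n-g2-g1∈N = by-decision (actF i1 n-g1-g1∈N)

n-g2-g2∈N : InN (n g2 g2)
n-g2-g2∈N = by-decision (scale ([ 2 ] i1 ⁻¹) (actF i1 n-g2-g1∈N))

n-g3-g1∈N : InN (n g3 g1)
n-g3-g1∈N = by-decision (actF i2 n-g2-g1∈N)

n-g3-g2∈N : InN (n g3 g2)
n-g3-g2∈N = by-decision (actF i2 n-g2-g2∈N)

n-g3-g3∈N : InN (n g3 g3)
n-g3-g3∈N = by-decision (scale ([ 2 ] i2 ⁻¹) (actF i2 n-g3-g2∈N))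

n-g0-g1∈N : InN (n g0 g1)
n-g0-g1∈N = by-decision (add (actF i1 n-g3-g1∈N) (scale (-F q^ 2) (actF i2 n-g2-g2∈N)))

n-g0-g2∈N : InN (n g0 g2)
n-g0-g2∈N = by-decision (actF i1 n-g3-g2∈N)

n-g0-g3∈N : InN (n g0 g3)
n-g0-g3∈N = by-decision (actF i1 n-g3-g3∈N)

n-g3'-g1∈N : InN (n g3' g1)
n-g3'-g1∈N = by-decision (scale ([ 2 ] i1 ⁻¹) (add (actF i1 n-g0-g1∈N) (scale (-F 1F) (actF i1 n-g3-g2∈N))))

n-g3'-g2∈N : InN (n g3' g2)
n-g3'-g2∈N = by-decision (scale ([ 2 ] i1 ⁻¹) (actF i1 n-g0-g2∈N))

n-g3'-g3∈N : InN (n g3' g3)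
n-g3'-g3∈N = by-decision (scale ([ 2 ] i1 ⁻¹) (actF i1 n-g0-g3∈N))

n-g3'-g0∈N : InN (n g3' g0)
n-g3'-g0∈N = by-decision (scale ([ 3 ] i1 ⁻¹) (actF i1 n-g3'-g3∈N))

n-g3'-g3'∈N : InN (n g3' g3')
n-g3'-g3'∈N = by-decision (scale ([ 4 ] i1 ⁻¹) (actF i1 n-g3'-g0∈N))

n-g2'-g1∈N : InN (n g2' g1)
n-g2'-g1∈N = by-decision (actF i2 n-g3'-g1∈N)

n-g2'-g2∈N : InN (n g2' g2)
n-g2'-g2∈N = by-decision (add (actF i2 n-g3'-g2∈N) (scale (-F q^ 3 *F [ 2 ] i1 ⁻¹) (actF i1 n-g0-g3∈N)))

n-g2'-g3∈N : InN (n g2' g3)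
n-g2'-g3∈N = by-decision (actF i2 n-g3'-g3∈N)

n-g2'-g0∈N : InN (n g2' g0)
n-g2'-g0∈N = by-decision (actF i2 n-g3'-g0∈N)

n-g2'-g3'∈N : InN (n g2' g3')
n-g2'-g3'∈N = by-decision (actF i2 n-g3'-g3'∈N)

n-g2'-g2'∈N : InN (n g2' g2')
n-g2'-g2'∈N = by-decision (scale ([ 2 ] i2 ⁻¹) (actF i2 n-g2'-g3'∈N))

n-g1'-g1∈N : InN (n g1' g1)
n-g1'-g1∈N = by-decision
  (add (actF i1 n-g2'-g1∈N) (add (scale (q^ 4 *F [ 2 ] i1 ⁻¹) (actF i1 n-g0-g3∈N))
                                 (scale (-F q^ 1) (actF i2 n-g3'-g2∈N))))

n-g1'-g2∈N : InN (n g1' g2)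
n-g1'-g2∈N = by-decision
  (add (actF i1 n-g2'-g2∈N) (scale (q^ 4 *F [ 2 ] i1 *F [ 3 ] i1 ⁻¹) (actF i1 n-g3'-g3∈N)))

n-g1'-g3∈N : InN (n g1' g3)
n-g1'-g3∈N = by-decision (actF i2 n-g1'-g2∈N)

n-g1'-g0∈N : InN (n g1' g0)
n-g1'-g0∈N = by-decision (add (actF i1 n-g2'-g0∈N) (scale (-F q^ 1 *F [ 2 ] i1) (actF i2 n-g3'-g3'∈N)))

n-g1'-g3'∈N : InN (n g1' g3')
n-g1'-g3'∈N = by-decision (actF i1 n-g2'-g3'∈N)

n-g1'-g2'∈N : InN (n g1' g2')
n-g1'-g2'∈N = by-decision (actF i1 n-g2'-g2'∈N)

n-g1'-g1'∈N : InN (n g1' g1')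
n-g1'-g1'∈N = by-decision (scale ([ 2 ] i1 ⁻¹) (actF i1 n-g1'-g2'∈N))

n∈N : ∀ x y → InN (n x y)
n∈N g1 g1   = n-g1-g1∈N
n∈N g1 g2   = zero∈N
n∈N g1 g3   = zero∈N
n∈N g1 g0   = zero∈N
n∈N g1 g3'  = zero∈N
n∈N g1 g2'  = zero∈N
n∈N g1 g1'  = zero∈N
n∈N g2 g1   = n-g2-g1∈N
n∈N g2 g2   = n-g2-g2∈N
n∈N g2 g3   = zero∈N
n∈N g2 g0   = zero∈N
n∈N g2 g3'  = zero∈N
n∈N g2 g2'  = zero∈N
n∈N g2 g1'  = zero∈N
n∈N g3 g1   = n-g3-g1∈N
n∈N g3 g2   = n-g3-g2∈N
n∈N g3 g3   = n-g3-g3∈N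
n∈N g3 g0   = zero∈N
n∈N g3 g3'  = zero∈N
n∈N g3 g2'  = zero∈N
n∈N g3 g1'  = zero∈N
n∈N g0 g1   = n-g0-g1∈N
n∈N g0 g2   = n-g0-g2∈N
n∈N g0 g3   = n-g0-g3∈N
n∈N g0 g0   = zero∈N
n∈N g0 g3'  = zero∈N
n∈N g0 g2'  = zero∈N
n∈N g0 g1'  = zero∈N
n∈N g3' g1  = n-g3'-g1∈N
n∈N g3' g2  = n-g3'-g2∈N
n∈N g3' g3  = n-g3'-g3∈N
n∈N g3' g0  = n-g3'-g0∈N
n∈N g3' g3' = n-g3'-g3'∈N
n∈N g3' g2' = zero∈N
n∈N g3' g1' = zero∈N
n∈N g2' g1  = n-g2'-g1∈N
n∈N g2' g2  = n-g2'-g2∈N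
n∈N g2' g3  = n-g2'-g3∈N
n∈N g2' g0  = n-g2'-g0∈N
n∈N g2' g3' = n-g2'-g3'∈N
n∈N g2' g2' = n-g2'-g2'∈N
n∈N g2' g1' = zero∈N
n∈N g1' g1  = n-g1'-g1∈N
n∈N g1' g2  = n-g1'-g2∈N
n∈N g1' g3  = n-g1'-g3∈N
n∈N g1' g0  = n-g1'-g0∈N
n∈N g1' g3' = n-g1'-g3'∈N
n∈N g1' g2' = n-g1'-g2'∈N
n∈N g1' g1' = n-g1'-g1'∈N

span∈N : ∀ w → InN (expand n w)
span∈N = expand-closed InN zero∈N add scale n n∈N

n-leading : ∀ x′ y′ x y → ¬ IsColumn x y → n x′ y′ x y ≈ δᴳ x x′ *F δᴳ y y′
n-leading = from-yes (∀G? λ x′ → ∀G? λ y′ → ∀G? λ x → ∀G? λ y →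
  ¬? (isColumn? x y) →-dec (n x′ y′ x y ≈? δᴳ x x′ *F δᴳ y y′))

comb-residual : ∀ (w s : V2) x y → (¬ IsColumn x y → s x y ≈ w x y) →
                (w -V comb (λ a b _ → w a b -F s a b)) x y ≈ s x y
comb-residual w s x y s≈w with isColumn? x y
... | yes _  = begin
  w x y -F (w x y -F s x y)   ≈⟨ +F-congˡ (w x y) (⁻¹-anti-homo‿- (w x y) (s x y)) ⟩
  w x y +F (s x y -F w x y)   ≈⟨ +F-assoc (w x y) (s x y) (-F w x y) ⟨
  w x y +F s x y -F w x y     ≈⟨ xyx⁻¹≈y (w x y) (s x y) ⟩
  s x y                       ∎
  where open ≈-Reasoning
... | no ¬xy = ≈-trans (+-identityʳ (w x y)) (≈-sym (s≈w ¬xy))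

spanning : (w : V2) → Σ Coeffs (λ c → InN (w -V comb c))
spanning w = (λ a b _ → w a b -F expand n w a b)
            , resp {expand n w} (λ x y → ≈⇒≈F (≈-sym (residual x y))) (span∈N w)
  where
  residual : ∀ x y → (w -V comb (λ a b _ → w a b -F expand n w a b)) x y ≈ expand n w x y
  residual x y = comb-residual w (expand n w) x y λ ¬xy → expand-sift n w x y λ x′ y′ → n-leading x′ y′ x y ¬xy

lemma4p2p2 : ((c : Coeffs) → InN (comb c) → (a b : G) (p : IsColumn a b) → c a b p ≈F 0F)
             × ((w : V2) → Σ Coeffs (λ c → InN (w -V comb c)))
lemma4p2p2 = independence , spanning
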